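{- Let $G$ be a 2-connected graph and $T$ a normal spanning tree of $G$ with root $r$, and suppose the vertices of $G$ are numbered with a numbering compatible with $T$. Let $a<b\in V(G)$ and let $c_1<\dots<c_k$ be the children of $b$. Let $\mathcal D$ be the set of children $d$ of $b$ with $lwpt(d)=a$ and $lwpt_2(d)=b$. Then $(A,B)$ is a half-connected type-2 separation of $G$ with separator $\{a,b\}$ if and only if all of the following hold: (1) there exists a child $a'$ of $a$ such that $b$ is a proper leftmost descendant of $a'$; (2) there exists $i\in\{0,1,\dots,k\}$ such that, if $T_2$ denotes the connected component of $T-\{a,b\}$ containing $a'$, then up to exchanging $A$ and $B$, $B=\{a,b\}\cup V(T_2)\cup\bigcup_{j\le i}Desc(c_j)$ and $A=V(G)\setminus(B\setminus\{a,b\})$; (3) $a\neq r$; (4) $T[a,b]$ is stable; (5) for every $j\le i$, $lwpt(c_j)\ge a$, and for every $j>i$, $hgpt(c_j)\le a$; (6) there do not exist $j,j'$ with $j\le i<j'$ and $c_j,c_{j'}\in\mathcal D$.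
   Context: A separation of $G$ is a pair $(A,B)$ with $A\cup B=V(G)$, $A\setminus B,B\setminus A\neq\emptyset$, no edge between $A\setminus B$ and $B\setminus A$; a 2-separation has $|A\cap B|=2$; half-connected means $G[A\setminus B]$ or $G[B\setminus A]$ is connected. $T$ is rooted at $r$; $p(v)$ is the parent; $T[u,v]$ is the $u$–$v$ path in $T$, $T(u,v)$ that path minus $u,v$; $Desc(v)$ is the set of descendants of $v$ (including $v$), $ND(v)=|Desc(v)|$; $T$ is normal if endpoints of every edge of $G$ are comparable; non-tree edges are back-edges $(x,y)$ with $x$ a descendant of $y$. $L(v)$ is the set of proper ancestors of $v$ adjacent to some vertex of $Desc(v)$; $lwpt_k(v)$ is the $k$-th element of $L(v)$ closest to the root if $|L(v)|\ge k$, else $v$; $lwpt=lwpt_1$; $hgpt(v)$ is the element of $L(v)\setminus\{p(v)\}$ farthest from the root if nonempty, else $v$. Vertices are identified with $[n]$; the numbering is compatible with $T$ if descendants of each $j$ form exactly $[j,j+ND(j)-1]$ and siblings $j<k$ satisfy $(-lwpt_1(j),lwpt_2(j))\le_{lex}(-lwpt_1(k),lwpt_2(k))$. The left child of a non-leaf is its largest child; $w$ is a leftmost descendant of $v$ if reached from $v$ by repeatedly taking left children (zero or more times). If $a'$ is a child of $a$ and $b$ a leftmost descendant of $a'$, $T[a,b]$ is a leftmost path; for $a<b$ it is stable if every back-edge $(x,y)$ with $a'\le x<b$ satisfies $y\ge a$; a path $T[a,b]$ that is not leftmost is not stable. A 2-separation with separator $\{a,b\}$ is type-2 if $r\notin\{a,b\}$,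 $V(T(a,b))\neq\emptyset$, and up to exchanging $A,B$, $r\in A\setminus B$ and $V(T(a,b))\subseteq B\setminus A$; otherwise type-1. -}

module Defs where

open import Data.Nat using (ℕ; _≤_; _<_; _+_)
open import Data.Fin using (Fin; toℕ)
open import Data.Fin.Subset using (Subset; _∈_; _∉_)
open import Data.Bool using (Bool; true; false)
open import Data.Product using (Σ; _×_; _,_; ∃)
open import Data.Sum using (_⊎_)
open import Relation.Binary.PropositionalEquality using (_≡_; _≢_)
open import Relation.Nullary using (¬_)

-- Vertices are Fin n (the paper's [n] = {1..n} shifted down by one,
-- which preserves the order); the order on vertices is that of toℕ.

_≤ᵥ_ : ∀ {n} → Fin n → Fin n → Set
u ≤ᵥ v = toℕ u ≤ toℕ v

_<ᵥ_ : ∀ {n} → Fin n → Fin n → Set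
u <ᵥ v = toℕ u < toℕ v

infix 3 _⟺_
_⟺_ : Set → Set → Set
X ⟺ Y = (X → Y) × (Y → X)

record Graph (n : ℕ) : Set where
  field
    adj    : Fin n → Fin n → Bool
    sym    : ∀ u v → adj u v ≡ adj v u
    irrefl : ∀ v → adj v v ≡ false

Edge : ∀ {n} → Graph n → Fin n → Fin n → Set
Edge G u v = Graph.adj G u v ≡ true

data Walk {n : ℕ} (R : Fin n → Fin n → Set) (P : Fin n → Set) : Fin n → Fin n → Set where
  stay : ∀ {u} → P u → Walk R P u u
  step : ∀ {u w v} → P u → R u w → Walk R P w v → Walk R P u v

ConnectedOn : ∀ {n} → (Fin n → Fin n → Set) → (Fin n → Set) → Set
ConnectedOn {n} R P = ∀ (u v : Fin n) → P u → P v → Walk R P u v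

TwoConnected : ∀ {n} → Graph n → Set
TwoConnected {n} G =
  (3 ≤ n) × ConnectedOn (Edge G) (λ _ → Fin n)
          × (∀ (x : Fin n) → ConnectedOn (Edge G) (λ v → v ≢ x))

-- Rooted trees given by a root r and a parent function p
-- (the value p r is irrelevant).

-- Anc r p u v : u is an ancestor of v (reflexively), i.e. v ∈ Desc(u).
data Anc {n : ℕ} (r : Fin n) (p : Fin n → Fin n) (u : Fin n) : Fin n → Set where
  here : Anc r p u u
  up   : ∀ {v} → v ≢ r → Anc r p u (p v) → Anc r p u v

-- A spanning tree of G rooted at r: every vertex reaches r by iterating
-- the parent map (so the edges {v, p v}, v ≠ r, form a spanning tree),
-- and every tree edge is an edge of G.
record RootedSpanningTree {n : ℕ} (G : Graph n) : Set where
  field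
    root     : Fin n
    parent   : Fin n → Fin n
    rooted   : ∀ v → Anc root parent root v
    treeEdge : ∀ v → v ≢ root → Edge G v (parent v)

module _ {n : ℕ} (G : Graph n) (T : RootedSpanningTree G) where
  open RootedSpanningTree T renaming (root to r; parent to p)

  IsAnc : Fin n → Fin n → Set
  IsAnc = Anc r p

  ProperAnc : Fin n → Fin n → Set
  ProperAnc u v = IsAnc u v × u ≢ v

  ChildOf : Fin n → Fin n → Set
  ChildOf c v = c ≢ r × p c ≡ v

  TreeEdge : Fin n → Fin n → Set
  TreeEdge u v = ChildOf u v ⊎ ChildOf v u

  Normal : Set
  Normal = ∀ u v → Edge G u v → IsAnc u v ⊎ IsAnc v u

  BackEdge : Fin n → Fin n → Set
  BackEdge x y = Edge G x y × IsAnc y x × ¬ TreeEdge x y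

  InL : Fin n → Fin n → Set
  InL v u = ProperAnc u v × Σ (Fin n) (λ w → IsAnc v w × Edge G w u)

  -- Lwpt1 v x : x = lwpt_1(v) = lwpt(v)
  -- (element of L(v) closest to the root, or v if L(v) = ∅)
  Lwpt1 : Fin n → Fin n → Set
  Lwpt1 v x =
    (InL v x × (∀ y → InL v y → IsAnc x y))
    ⊎ ((∀ y → ¬ InL v y) × x ≡ v)

  -- Lwpt2 v x : x = lwpt_2(v)
  -- (second element of L(v) closest to the root, or v if |L(v)| < 2)
  Lwpt2 : Fin n → Fin n → Set
  Lwpt2 v x =
    (InL v x × Σ (Fin n) (λ y → InL v y × ProperAnc y x
                                 × (∀ z → InL v z → z ≡ y ⊎ IsAnc x z)))
    ⊎ ((∀ y z → InL v y → InL v z → y ≡ z) × x ≡ v)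

  -- Hgpt v x : x = hgpt(v)
  -- (element of L(v) ∖ {p(v)} farthest from the root, or v if empty)
  Hgpt : Fin n → Fin n → Set
  Hgpt v x =
    (InL v x × x ≢ p v × (∀ y → InL v y → y ≢ p v → IsAnc y x))
    ⊎ ((∀ y → InL v y → y ≡ p v) × x ≡ v)

  -- The numbering (identity on Fin n) is compatible with T:
  -- Desc(j) is the interval [j, j + ND(j) - 1] (the length m of the
  -- interval is necessarily ND(j) = |Desc(j)|), and siblings j < k satisfy
  -- (-lwpt1 j, lwpt2 j) ≤lex (-lwpt1 k, lwpt2 k).
  Compatible : Set
  Compatible =
    (∀ j → Σ ℕ (λ m → ∀ w → (IsAnc j w → toℕ j ≤ toℕ w × toℕ w < toℕ j + m)
                           × (toℕ j ≤ toℕ w × toℕ w < toℕ j + m → IsAnc j w)))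
    × (∀ j k → j ≢ r → k ≢ r → p j ≡ p k → j <ᵥ k →
         ∀ l1j l2j l1k l2k → Lwpt1 j l1j → Lwpt2 j l2j → Lwpt1 k l1k → Lwpt2 k l2k →
         (l1k <ᵥ l1j) ⊎ (l1j ≡ l1k × l2j ≤ᵥ l2k))

  -- left child: the largest child
  IsLeftChild : Fin n → Fin n → Set
  IsLeftChild v c = ChildOf c v × (∀ c' → ChildOf c' v → c' ≤ᵥ c)

  data LeftmostDesc : Fin n → Fin n → Set where
    lm-here : ∀ {v} → LeftmostDesc v v
    lm-step : ∀ {v c w} → IsLeftChild v c → LeftmostDesc c w → LeftmostDesc v w

  -- T[a,b] is a leftmost path (via the child a' of a), a < b, and it is
  -- stable (a path that is not leftmost is not stable).
  Stable : Fin n → Fin n → Set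
  Stable a b = a <ᵥ b × Σ (Fin n) (λ a' → ChildOf a' a × LeftmostDesc a' b
                 × (∀ x y → BackEdge x y → a' ≤ᵥ x → x <ᵥ b → a ≤ᵥ y))

  -- w ∈ V(T[u,v]): w is an ancestor of u or of v, and a descendant of
  -- every common ancestor of u and v (i.e. of their lowest common ancestor)
  OnTreePath : Fin n → Fin n → Fin n → Set
  OnTreePath u v w = (IsAnc w u ⊎ IsAnc w v)
                     × (∀ z → IsAnc z u → IsAnc z v → IsAnc z w)

  InTreePathInterior : Fin n → Fin n → Fin n → Set
  InTreePathInterior u v w = OnTreePath u v w × w ≢ u × w ≢ v

  IsSeparation : Subset n → Subset n → Set
  IsSeparation A B =
    (∀ v → v ∈ A ⊎ v ∈ B)
    × Σ (Fin n) (λ v → v ∈ A × v ∉ B)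
    × Σ (Fin n) (λ v → v ∈ B × v ∉ A)
    × (∀ u v → u ∈ A → u ∉ B → v ∈ B → v ∉ A → ¬ Edge G u v)

  HasSeparator : Subset n → Subset n → Fin n → Fin n → Set
  HasSeparator A B a b = ∀ v → (v ∈ A × v ∈ B → v ≡ a ⊎ v ≡ b)
                               × (v ≡ a ⊎ v ≡ b → v ∈ A × v ∈ B)

  HalfConnected : Subset n → Subset n → Set
  HalfConnected A B = ConnectedOn (Edge G) (λ v → v ∈ A × v ∉ B)
                      ⊎ ConnectedOn (Edge G) (λ v → v ∈ B × v ∉ A)

  Type2 : Subset n → Subset n → Fin n → Fin n → Set
  Type2 A B a b =
    r ≢ a × r ≢ b × Σ (Fin n) (InTreePathInterior a b)
    × (   ((r ∈ A × r ∉ B) × (∀ w → InTreePathInterior a b w → w ∈ B × w ∉ A))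
        ⊎ ((r ∈ B × r ∉ A) × (∀ w → InTreePathInterior a b w → w ∈ A × w ∉ B)))

  HalfConnType2SepWith : Subset n → Subset n → Fin n → Fin n → Set
  HalfConnType2SepWith A B a b =
    IsSeparation A B × HasSeparator A B a b × HalfConnected A B × Type2 A B a b

  InComponentAvoiding : Fin n → Fin n → Fin n → Fin n → Set
  InComponentAvoiding a b a' w = Walk TreeEdge (λ v → v ≢ a × v ≢ b) a' w

  -- the shape of B (and A) required in condition (2), for the sorted list
  -- c : Fin k → Fin n of the children of b and the cut index i
  ShapeB : Subset n → Subset n → Fin n → Fin n → Fin n →
           (k : ℕ) → (Fin k → Fin n) → ℕ → Set
  ShapeB A B a b a' k c i = ∀ v →
      (v ∈ B ⟺ (v ≡ a ⊎ v ≡ b ⊎ InComponentAvoiding a b a' v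
                  ⊎ Σ (Fin k) (λ j → toℕ j < i × IsAnc (c j) v)))
    × (v ∈ A ⟺ (¬ (v ∈ B × ¬ (v ≡ a ⊎ v ≡ b))))

module Submission where

open import Defs
open import Data.Nat using (ℕ; zero; suc; z≤n; s≤s; _≤_; _<_; _≤?_; _<?_)
import Data.Nat as ℕ
open import Data.Nat.Properties
  using (≤-refl; ≤-trans; ≤-<-trans; <-≤-trans; <-trans; <⇒≤; <⇒≱; <⇒≯; ≤⇒≯; ≰⇒>; ≮⇒≥; ≤∧≢⇒<;
         <-irrefl; <-cmp; m≤n⇒m<n∨m≡n)
open import Data.Fin using (Fin; toℕ; fromℕ<)
import Data.Fin as Fin
open import Data.Fin.Properties using (any?; toℕ-injective; toℕ<n; toℕ-fromℕ<) renaming (_≟_ to _≟ᶠ_)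
import Data.Fin.Properties as Finₚ
open import Data.Fin.Subset using (Subset; _∈_; _∉_)
open import Data.Fin.Subset.Properties using (_∈?_)
open import Data.Bool using (true)
import Data.Bool.Properties as Boolₚ
open import Data.Product using (Σ; _×_; _,_; proj₁; proj₂; ∃; ∃-syntax)
open import Data.Sum using (_⊎_; inj₁; inj₂; map₁; swap)
open import Data.Empty using (⊥; ⊥-elim)
open import Function using (_∘_; id)
open import Relation.Binary.PropositionalEquality using (_≡_; _≢_; refl; sym; trans; cong; subst)
open import Relation.Binary.Definitions using (tri<; tri≈; tri>)
open import Relation.Nullary using (¬_; Dec; yes; no; _×-dec_; _⊎-dec_; ¬?; decidable-stable; contradiction)
open import Relation.Unary using (Decidable)

-- Normality confines every edge to a root path of T, and 2-connectivity gives every subtree hanging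
-- below a non-root vertex an edge to a proper ancestor other than its parent. Hence the side of a
-- type-2 separation with separator {a, b} that avoids the root is Desc(a′) ∖ Desc(b), for the child a′
-- of a towards b, together with some of the subtrees Desc(c_j). A child c_j on the root side has
-- hgpt(c_j) ≤ a and one on the other side has lwpt(c_j) ≥ a, so the lexicographic order of a
-- compatible numbering lists the latter first, which yields the cut index i. The same order makes
-- every step of the path from a′ to b go to the largest child, so T[a, b] is leftmost, and back-edges
-- from Desc(a′) ∖ Desc(b) cannot pass above a, which is stability. Conversely, stability and (5)
-- exclude every edge leaving the set described in (2). Half-connectivity is where 𝒟 enters: a child
-- c_j with L(c_j) ⊆ {a, b}, that is c_j ∈ 𝒟, can only be left through a or b, so it disconnects its
-- side, and (6) says that one of the two sides contains no such child.

least-witness : ∀ {m} {P : Fin m → Set} → Decidable P → ∃ P →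
                ∃[ x ] (P x × ∀ y → P y → x ≤ᵥ y)
least-witness {suc m} P? (w , Pw) with P? Fin.zero
... | yes P0 = Fin.zero , P0 , λ _ _ → z≤n
least-witness {suc m} P? (Fin.zero , P0) | no ¬P0 = contradiction P0 ¬P0
least-witness {suc m} P? (Fin.suc w , Pw) | no ¬P0
  with least-witness (P? ∘ Fin.suc) (w , Pw)
... | x , Px , least = Fin.suc x , Px , λ where
  Fin.zero    P0 → contradiction P0 ¬P0
  (Fin.suc y) Py → s≤s (least y Py)

greatest-witness : ∀ {m} {P : Fin m → Set} → Decidable P → ∃ P →
                   ∃[ x ] (P x × ∀ y → P y → y ≤ᵥ x)
greatest-witness {suc m} P? (w , Pw) with any? (P? ∘ Fin.suc)
... | yes above with greatest-witness (P? ∘ Fin.suc) above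
...   | x , Px , greatest = Fin.suc x , Px , λ where
  Fin.zero    _  → z≤n
  (Fin.suc y) Py → s≤s (greatest y Py)
greatest-witness {suc m} P? (Fin.zero , P0) | no none = Fin.zero , P0 , λ where
  Fin.zero    _  → z≤n
  (Fin.suc y) Py → contradiction (y , Py) none
greatest-witness {suc m} P? (Fin.suc w , Pw) | no none = contradiction (w , Pw) none

longest-prefix : ∀ {m} {P : Fin m → Set} → Decidable P →
                 ∃[ i ] (i ≤ m × (∀ j → toℕ j < i → P j) × (∀ j → toℕ j ≡ i → ¬ P j))
longest-prefix {zero} P? = 0 , z≤n , (λ ()) , (λ ())
longest-prefix {suc m} P? with P? Fin.zero
... | no ¬P0 = 0 , z≤n , (λ _ ()) , λ where
  Fin.zero    _  → ¬P0
  (Fin.suc j) ()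
... | yes P0 with longest-prefix (P? ∘ Fin.suc)
...   | i , i≤m , below , at = suc i , s≤s i≤m , (λ where
          Fin.zero    _         → P0
          (Fin.suc j) (s≤s j<i) → below j j<i) , λ where
          Fin.zero    ()
          (Fin.suc j) j≡i → at j (cong ℕ.pred j≡i)

module _ {n : ℕ} where

  walk-map : ∀ {R R′ : Fin n → Fin n → Set} {P P′ : Fin n → Set} →
             (∀ {x y} → R x y → R′ x y) → (∀ {x} → P x → P′ x) →
             ∀ {u v} → Walk R P u v → Walk R′ P′ u v
  walk-map f g (stay p)     = stay (g p)
  walk-map f g (step p e w) = step (g p) (f e) (walk-map f g w)

  connected-on-⇔ : ∀ {R : Fin n → Fin n → Set} {P Q : Fin n → Set} →
                   (∀ {v} → P v → Q v) → (∀ {v} → Q v → P v) → ConnectedOn R P → ConnectedOn R Q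
  connected-on-⇔ P⇒Q Q⇒P connected u v Qu Qv = walk-map id P⇒Q (connected u v (Q⇒P Qu) (Q⇒P Qv))

  module _ {R : Fin n → Fin n → Set} {P : Fin n → Set} where

    walk-++ : ∀ {u v w} → Walk R P u v → Walk R P v w → Walk R P u w
    walk-++ (stay _)      w₂ = w₂
    walk-++ (step p e w₁) w₂ = step p e (walk-++ w₁ w₂)

    walk-source : ∀ {u v} → Walk R P u v → P u
    walk-source (stay p)     = p
    walk-source (step p _ _) = p

    walk-snoc : ∀ {u v w} → Walk R P u v → R v w → P w → Walk R P u w
    walk-snoc w e p = walk-++ w (step (walk-target w) e (stay p))
      where
      walk-target : ∀ {u v} → Walk R P u v → P v
      walk-target (stay p)     = p
      walk-target (step _ _ w) = walk-target w

    walk-reverse : (∀ {x y} → R x y → R y x) → ∀ {u v} → Walk R P u v → Walk R P v u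
    walk-reverse R-sym (stay p)     = stay p
    walk-reverse R-sym (step p e w) = walk-snoc (walk-reverse R-sym w) (R-sym e) p

    walk-transport : ∀ {Q : Fin n → Set} → (∀ {x y} → Q x → R x y → P y → Q y) →
                     ∀ {u v} → Walk R P u v → Q u → Q v
    walk-transport Q-closed (stay _)        Qu = Qu
    walk-transport Q-closed (step _ e rest) Qu = walk-transport Q-closed rest (Q-closed Qu e (walk-source rest))

    connected-through : (∀ {x y} → R x y → R y x) → ∀ {hub} →
                        (∀ {u} → P u → Walk R P u hub) → ConnectedOn R P
    connected-through R-sym to-hub u v Pu Pv = walk-++ (to-hub Pu) (walk-reverse R-sym (to-hub Pv))

    walk-exit : ∀ {Q : Fin n → Set} → Decidable Q → ∀ {u v} → Walk R P u v → Q u → ¬ Q v →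
                ∃[ x ] ∃[ y ] (Q x × ¬ Q y × R x y × P x × P y)
    walk-exit Q? (stay _) Qu ¬Qv = contradiction Qu ¬Qv
    walk-exit Q? (step {w = w} p e rest) Qu ¬Qv with Q? w
    ... | yes Qw = walk-exit Q? rest Qw ¬Qv
    ... | no ¬Qw = _ , w , Qu , ¬Qw , e , p , walk-source rest

module TreeProperties {n : ℕ} (G : Graph n) (T : RootedSpanningTree G) (compatible : Compatible G T) where
  open RootedSpanningTree T renaming (root to r; parent to p)

  infix 4 _≼_
  _≼_ : Fin n → Fin n → Set
  _≼_ = IsAnc G T

  Child : Fin n → Fin n → Set
  Child = ChildOf G T

  edge-sym : ∀ {x y} → Edge G x y → Edge G y x
  edge-sym {x} {y} e = trans (Graph.sym G y x) e

  edge? : ∀ x y → Dec (Edge G x y)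
  edge? x y = Graph.adj G x y Boolₚ.≟ true

  child-edge : ∀ {c v} → Child c v → Edge G c v
  child-edge (c≢r , refl) = treeEdge _ c≢r

  tree-edge⇒edge : ∀ {u v} → TreeEdge G T u v → Edge G u v
  tree-edge⇒edge (inj₁ u↑v) = child-edge u↑v
  tree-edge⇒edge (inj₂ v↑u) = edge-sym (child-edge v↑u)

  tree-edge-sym : ∀ {u v} → TreeEdge G T u v → TreeEdge G T v u
  tree-edge-sym (inj₁ x) = inj₂ x
  tree-edge-sym (inj₂ x) = inj₁ x

  ≼-trans : ∀ {u v w} → u ≼ v → v ≼ w → u ≼ w
  ≼-trans u≼v here         = u≼v
  ≼-trans u≼v (up w≢r u≼pw) = up w≢r (≼-trans u≼v u≼pw)

  child⇒≼ : ∀ {c v} → Child c v → v ≼ c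
  child⇒≼ (c≢r , refl) = up c≢r here

  r≼ : ∀ v → r ≼ v
  r≼ = rooted

  ancestors-comparable : ∀ {x y v} → x ≼ v → y ≼ v → x ≼ y ⊎ y ≼ x
  ancestors-comparable here         y≼v          = inj₂ y≼v
  ancestors-comparable (up v≢r x≼pv) here          = inj₁ (up v≢r x≼pv)
  ancestors-comparable (up _ x≼pv)   (up _ y≼pv)   = ancestors-comparable x≼pv y≼pv

  ≼-parent : ∀ {u v} → u ≼ v → u ≢ v → u ≼ p v × v ≢ r
  ≼-parent here          u≢v = contradiction refl u≢v
  ≼-parent (up v≢r u≼pv) _   = u≼pv , v≢r

  child-on-path : ∀ {v x} → v ≼ x → v ≢ x → ∃[ c ] (Child c v × c ≼ x)
  child-on-path here ne = contradiction refl ne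
  child-on-path {v} (up {x} x≢r v≼px) _ with v ≟ᶠ p x
  ... | yes v≡px = x , (x≢r , sym v≡px) , here
  ... | no v≢px with child-on-path v≼px v≢px
  ...   | c , c↑v , c≼px = c , c↑v , up x≢r c≼px

  walk-up : ∀ {P : Fin n → Set} {x v} → x ≼ v → (∀ z → x ≼ z → z ≼ v → P z) →
            Walk (TreeEdge G T) P v x
  walk-up here         P-on = stay (P-on _ here here)
  walk-up (up v≢r x≼pv) P-on =
    step (P-on _ (up v≢r x≼pv) here) (inj₁ (v≢r , refl))
         (walk-up x≼pv (λ z x≼z z≼pv → P-on z x≼z (up v≢r z≼pv)))

  walk-within : ∀ {P : Fin n → Set} x {u w} → x ≼ u → x ≼ w → (∀ z → x ≼ z → P z) →
                Walk (Edge G) P u w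
  walk-within x x≼u x≼w P-below =
    walk-++ (up-to x≼u) (walk-reverse edge-sym (up-to x≼w))
    where
    up-to : ∀ {v} → x ≼ v → Walk (Edge G) _ v x
    up-to x≼v = walk-map tree-edge⇒edge id (walk-up x≼v (λ z x≼z _ → P-below z x≼z))

  ≼⇒≤ᵥ : ∀ {u v} → u ≼ v → u ≤ᵥ v
  ≼⇒≤ᵥ {u} {v} u≼v = proj₁ (proj₁ (proj₂ (proj₁ compatible u) v) u≼v)

  ≼-antisym : ∀ {u v} → u ≼ v → v ≼ u → u ≡ v
  ≼-antisym u≼v v≼u = Finₚ.≤-antisym (≼⇒≤ᵥ u≼v) (≼⇒≤ᵥ v≼u)

  ≼-r⇒≡r : ∀ {u} → u ≼ r → u ≡ r
  ≼-r⇒≡r u≼r = ≼-antisym u≼r (r≼ _)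

  _≼?_ : ∀ u v → Dec (u ≼ v)
  u ≼? v with proj₁ compatible u
  ... | size , interval with toℕ u ≤? toℕ v | toℕ v <? toℕ u ℕ.+ size
  ... | yes u≤v | yes v<end = yes (proj₂ (interval v) (u≤v , v<end))
  ... | no  u≰v | _         = no (u≰v ∘ proj₁ ∘ proj₁ (interval v))
  ... | yes _   | no  v≮end = no (v≮end ∘ proj₂ ∘ proj₁ (interval v))

  ≼-between : ∀ {j w} x → j ≼ w → j ≤ᵥ x → x ≤ᵥ w → j ≼ x
  ≼-between {j} {w} x j≼w j≤x x≤w with proj₁ compatible j
  ... | size , interval = proj₂ (interval x) (j≤x , ≤-<-trans x≤w (proj₂ (proj₁ (interval w) j≼w)))

  ≤ᵥ⇒≼ : ∀ {x y v} → x ≼ v → y ≼ v → x ≤ᵥ y → x ≼ y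
  ≤ᵥ⇒≼ x≼v y≼v x≤y with ancestors-comparable x≼v y≼v
  ... | inj₁ x≼y = x≼y
  ... | inj₂ y≼x = subst (_ ≼_) (sym (Finₚ.≤-antisym (≼⇒≤ᵥ y≼x) x≤y)) here

  ≼∧≢⇒<ᵥ : ∀ {u v} → u ≼ v → u ≢ v → u <ᵥ v
  ≼∧≢⇒<ᵥ u≼v u≢v = ≤∧≢⇒< (≼⇒≤ᵥ u≼v) (u≢v ∘ toℕ-injective)

  <ᵥ⇒⋠ : ∀ {u v} → v <ᵥ u → ¬ u ≼ v
  <ᵥ⇒⋠ v<u u≼v = ≤⇒≯ (≼⇒≤ᵥ u≼v) v<u

  parent≢self : ∀ {v} → v ≢ r → p v ≢ v
  parent≢self {v} v≢r pv≡v = climb (r≼ v) refl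
    where
    climb : ∀ {y} → r ≼ y → y ≡ v → ⊥
    climb here          r≡v  = v≢r (sym r≡v)
    climb (up _ r≼py) refl = climb r≼py pv≡v

  child⇒>ᵥ : ∀ {c v} → Child c v → v <ᵥ c
  child⇒>ᵥ (c≢r , refl) = ≼∧≢⇒<ᵥ (child⇒≼ (c≢r , refl)) (parent≢self c≢r)

  child≢parent : ∀ {c v} → Child c v → c ≢ v
  child≢parent c↑v c≡v = Finₚ.<-irrefl (sym c≡v) (child⇒>ᵥ c↑v)

  siblings-nested⇒≡ : ∀ {c c′ v} → Child c v → Child c′ v → c ≼ c′ → c ≡ c′
  siblings-nested⇒≡ {c} {c′} c↑v c′↑v c≼c′ with c ≟ᶠ c′
  ... | yes c≡c′ = c≡c′
  ... | no  c≢c′ = contradiction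
          (≼-antisym (subst (c ≼_) (proj₂ c′↑v) (proj₁ (≼-parent c≼c′ c≢c′))) (child⇒≼ c↑v))
          (child≢parent c↑v)

  siblings-with-common-descendant : ∀ {x y v w} → Child x v → Child y v → x ≼ w → y ≼ w → x ≡ y
  siblings-with-common-descendant x↑v y↑v x≼w y≼w with ancestors-comparable x≼w y≼w
  ... | inj₁ x≼y = siblings-nested⇒≡ x↑v y↑v x≼y
  ... | inj₂ y≼x = sym (siblings-nested⇒≡ y↑v x↑v y≼x)

  InL? : ∀ v u → Dec (InL G T v u)
  InL? v u = ((u ≼? v) ×-dec ¬? (u ≟ᶠ v)) ×-dec any? (λ w → (v ≼? w) ×-dec edge? w u)

  InL-except? : ∀ v x → Decidable (λ y → InL G T v y × y ≢ x)
  InL-except? v x y = InL? v y ×-dec ¬? (y ≟ᶠ x)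

  InL⇒≼ : ∀ {v u} → InL G T v u → u ≼ v
  InL⇒≼ ((u≼v , _) , _) = u≼v

  parent∈L : ∀ {x v} → Child x v → InL G T x v
  parent∈L x↑v = (child⇒≼ x↑v , child≢parent x↑v ∘ sym) , _ , here , child-edge x↑v

  InL⇒≼parent : ∀ {x v u} → Child x v → InL G T x u → u ≼ v
  InL⇒≼parent (_ , refl) ((u≼x , u≢x) , _) = proj₁ (≼-parent u≼x u≢x)

  lwpt₁≤L : ∀ {v y l} → InL G T v y → Lwpt1 G T v l → l ≤ᵥ y
  lwpt₁≤L y∈L (inj₁ (_ , lowest)) = ≼⇒≤ᵥ (lowest _ y∈L)
  lwpt₁≤L y∈L (inj₂ (L-empty , _)) = contradiction y∈L (L-empty _)

  L≤hgpt : ∀ {v y h} → InL G T v y → y ≢ p v → Hgpt G T v h → y ≤ᵥ h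
  L≤hgpt y∈L y≢pv (inj₁ (_ , _ , highest)) = ≼⇒≤ᵥ (highest _ y∈L y≢pv)
  L≤hgpt y∈L y≢pv (inj₂ (L⊆parent , _))    = contradiction (L⊆parent _ y∈L) y≢pv

  -- Since L(v) lies on the root path of v, its closest-to-root elements are its least numbers.
  lwpt₁-exists : ∀ v → ∃ (Lwpt1 G T v)
  lwpt₁-exists v with any? (InL? v)
  ... | no  L-empty = v , inj₂ ((λ y y∈L → L-empty (y , y∈L)) , refl)
  ... | yes L-inhabited with least-witness (InL? v) L-inhabited
  ...   | x , x∈L , least = x , inj₁ (x∈L , λ y y∈L → ≤ᵥ⇒≼ (InL⇒≼ x∈L) (InL⇒≼ y∈L) (least y y∈L))

  lwpt₂-exists : ∀ v → ∃ (Lwpt2 G T v)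
  lwpt₂-exists v with any? (InL? v)
  ... | no L-empty = v , inj₂ ((λ y _ y∈L _ → contradiction (y , y∈L) L-empty) , refl)
  ... | yes L-inhabited with least-witness (InL? v) L-inhabited
  ...   | x₁ , x₁∈L , least₁ with any? (InL-except? v x₁)
  ...     | no  L⊆x₁ = v , inj₂ ((λ y z y∈L z∈L → trans (only-x₁ y∈L) (sym (only-x₁ z∈L))) , refl)
    where
    only-x₁ : ∀ {y} → InL G T v y → y ≡ x₁
    only-x₁ {y} y∈L = decidable-stable (y ≟ᶠ x₁) (λ y≢x₁ → L⊆x₁ (y , y∈L , y≢x₁))
  ...     | yes second with least-witness (InL-except? v x₁) second
  ...       | x₂ , (x₂∈L , x₂≢x₁) , least₂ =
    x₂ , inj₁ (x₂∈L , x₁ , x₁∈L , (≤ᵥ⇒≼ (InL⇒≼ x₁∈L) (InL⇒≼ x₂∈L) (least₁ x₂ x₂∈L) , x₂≢x₁ ∘ sym) ,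
               rest)
    where
    rest : ∀ z → InL G T v z → z ≡ x₁ ⊎ x₂ ≼ z
    rest z z∈L with z ≟ᶠ x₁
    ... | yes z≡x₁ = inj₁ z≡x₁
    ... | no  z≢x₁ = inj₂ (≤ᵥ⇒≼ (InL⇒≼ x₂∈L) (InL⇒≼ z∈L) (least₂ z (z∈L , z≢x₁)))

  sibling-lwpt₁-antitone : ∀ {j k l m} → j ≢ r → k ≢ r → p j ≡ p k → j <ᵥ k →
                          Lwpt1 G T j l → Lwpt1 G T k m → m ≤ᵥ l
  sibling-lwpt₁-antitone {j} {k} j≢r k≢r same-parent j<k lw mw
    with proj₂ compatible j k j≢r k≢r same-parent j<k _ _ _ _ lw (proj₂ (lwpt₂-exists j)) mw (proj₂ (lwpt₂-exists k))
  ... | inj₁ m<l       = <⇒≤ m<l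
  ... | inj₂ (refl , _) = ≤-refl

  hgpt-exists : ∀ v → ∃ (Hgpt G T v)
  hgpt-exists v with any? (InL-except? v (p v))
  ... | no  L⊆p = v , inj₂ ((λ y y∈L → decidable-stable (y ≟ᶠ p v) (λ y≢p → L⊆p (y , y∈L , y≢p))) , refl)
  ... | yes inhabited with greatest-witness (InL-except? v (p v)) inhabited
  ...   | x , (x∈L , x≢p) , greatest =
    x , inj₁ (x∈L , x≢p , λ y y∈L y≢p → ≤ᵥ⇒≼ (InL⇒≼ y∈L) (InL⇒≼ x∈L) (greatest y (y∈L , y≢p)))

  leftmost⇒≼ : ∀ {x y} → LeftmostDesc G T x y → x ≼ y
  leftmost⇒≼ lm-here                 = here
  leftmost⇒≼ (lm-step (c↑x , _) rest) = ≼-trans (child⇒≼ c↑x) (leftmost⇒≼ rest)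

  leftmost-snoc : ∀ {x y z} → LeftmostDesc G T x y → IsLeftChild G T y z → LeftmostDesc G T x z
  leftmost-snoc lm-here           z-left = lm-step z-left lm-here
  leftmost-snoc (lm-step c-left rest) z-left = lm-step c-left (leftmost-snoc rest z-left)

  leftmost-≤ᵥ⇒≼ : ∀ {x y v} → LeftmostDesc G T x y → x ≼ v → y ≤ᵥ v → y ≼ v
  leftmost-≤ᵥ⇒≼ lm-here x≼v _ = x≼v
  leftmost-≤ᵥ⇒≼ {x} {y} {v} (lm-step {c = c} (c↑x , largest) rest) x≼v y≤v
    with child-on-path x≼v (λ x≡v → ≤⇒≯ c≤v (subst (_<ᵥ c) x≡v (child⇒>ᵥ c↑x)))
    where
    c≤v : c ≤ᵥ v
    c≤v = ≤-trans (≼⇒≤ᵥ (leftmost⇒≼ rest)) y≤v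
  ... | c′ , c′↑x , c′≼v = leftmost-≤ᵥ⇒≼ rest (subst (_≼ v) c′≡c c′≼v) y≤v
    where
    c′≡c : c′ ≡ c
    c′≡c = siblings-nested⇒≡ c′↑x c↑x
             (≼-between c c′≼v (largest c′ c′↑x) (≤-trans (≼⇒≤ᵥ (leftmost⇒≼ rest)) y≤v))

  stable-back-edges : ∀ {a b a′} → Stable G T a b → Child a′ a → LeftmostDesc G T a′ b →
                      ∀ x y → BackEdge G T x y → a′ ≤ᵥ x → x <ᵥ b → a ≤ᵥ y
  stable-back-edges (_ , a″ , a″↑a , lm″ , condition) a′↑a lm x y back a′≤x =
    condition x y back
      (subst (_≤ᵥ x) (siblings-with-common-descendant a′↑a a″↑a (leftmost⇒≼ lm) (leftmost⇒≼ lm″)) a′≤x)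

  -- By normality, the edge on which the walk leaves Desc(x) ends in a proper ancestor of x.
  subtree-exit : Normal G T → ∀ {Q : Fin n → Set} {x u t} → Walk (Edge G) Q u t → x ≼ u → ¬ x ≼ t →
                 ∃[ y ] (InL G T x y × Q y)
  subtree-exit normal {x = x} walk x≼u x⋠t with walk-exit (x ≼?_) walk x≼u x⋠t
  ... | w , y , x≼w , x⋠y , e , _ , Qy with normal w y e
  ...   | inj₁ w≼y = contradiction (≼-trans x≼w w≼y) x⋠y
  ...   | inj₂ y≼w with ancestors-comparable y≼w x≼w
  ...     | inj₂ x≼y = contradiction x≼y x⋠y
  ...     | inj₁ y≼x = y , ((y≼x , λ y≡x → x⋠y (subst (x ≼_) (sym y≡x) here)) , w , x≼w , e) , Qy

  InL-beyond-parent : TwoConnected G → Normal G T → ∀ {c} → c ≢ r → p c ≢ r →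
                      ∃[ y ] (InL G T c y × y ≢ p c)
  InL-beyond-parent (_ , _ , no-cut-vertex) normal {c} c≢r pc≢r =
    subtree-exit normal (no-cut-vertex (p c) c r (parent≢self c≢r ∘ sym) (pc≢r ∘ sym)) here
                 (c≢r ∘ ≼-r⇒≡r)

module Setting {n : ℕ} (G : Graph n) (T : RootedSpanningTree G)
               (two-connected : TwoConnected G) (normal : Normal G T) (compatible : Compatible G T)
               (a b : Fin n) (a<b : a <ᵥ b) (k : ℕ) (c : Fin k → Fin n)
               (c-increasing : ∀ (j j′ : Fin k) → toℕ j < toℕ j′ → c j <ᵥ c j′)
               (children-of-b : ∀ v → ChildOf G T v b ⟺ Σ (Fin k) (λ j → c j ≡ v)) where

  open RootedSpanningTree T renaming (root to r; parent to p)
  open TreeProperties G T compatible public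

  a≢b : a ≢ b
  a≢b a≡b = Finₚ.<-irrefl a≡b a<b

  b≢r : b ≢ r
  b≢r b≡r = <ᵥ⇒⋠ a<b (subst (_≼ a) (sym b≡r) (r≼ a))

  c↑b : ∀ j → Child (c j) b
  c↑b j = proj₂ (children-of-b (c j)) (j , refl)

  b<c : ∀ j → b <ᵥ c j
  b<c j = child⇒>ᵥ (c↑b j)

  c-injective : ∀ {j j′} → c j ≡ c j′ → toℕ j ≡ toℕ j′
  c-injective {j} {j′} cj≡cj′ with <-cmp (toℕ j) (toℕ j′)
  ... | tri< j<j′ _ _ = contradiction (c-increasing j j′ j<j′) (Finₚ.<-irrefl cj≡cj′)
  ... | tri≈ _ j≡j′ _ = j≡j′
  ... | tri> _ _ j′<j = contradiction (c-increasing j′ j j′<j) (Finₚ.<-irrefl (sym cj≡cj′))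

  child-of-b-index : ∀ {x} → Child x b → ∃[ j ] (c j ≡ x)
  child-of-b-index x↑b = proj₁ (children-of-b _) x↑b

  below-b⇒below-child : ∀ {u} → b ≼ u → u ≢ b → ∃[ j ] (c j ≼ u)
  below-b⇒below-child b≼u u≢b with child-on-path b≼u (u≢b ∘ sym)
  ... | x , x↑b , x≼u with child-of-b-index x↑b
  ...   | j , refl = j , x≼u

  below-child-of-b-avoids : ∀ {x v} → Child x b → x ≼ v → v ≢ a × v ≢ b
  below-child-of-b-avoids x↑b x≼v =
    (λ v≡a → <ᵥ⇒⋠ (<-trans a<b (child⇒>ᵥ x↑b)) (subst (_ ≼_) v≡a x≼v)) ,
    (λ v≡b → <ᵥ⇒⋠ (child⇒>ᵥ x↑b) (subst (_ ≼_) v≡b x≼v))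

  Escapes : Fin n → Set
  Escapes x = ∃[ z ] (InL G T x z × z ≢ a × z ≢ b)

  Escapes? : Decidable Escapes
  Escapes? x = any? (λ z → InL? x z ×-dec ¬? (z ≟ᶠ a) ×-dec ¬? (z ≟ᶠ b))

  Trapped : Fin n → Set
  Trapped x = ∀ z → InL G T x z → z ≡ a ⊎ z ≡ b

  ¬escapes⇒trapped : ∀ {x} → ¬ Escapes x → Trapped x
  ¬escapes⇒trapped {x} stuck z z∈L with z ≟ᶠ a | z ≟ᶠ b
  ... | yes z≡a | _       = inj₁ z≡a
  ... | no  _   | yes z≡b = inj₂ z≡b
  ... | no  z≢a | no  z≢b = contradiction (z , z∈L , z≢a , z≢b) stuck

  InD : Fin n → Set
  InD x = Child x b × Lwpt1 G T x a × Lwpt2 G T x b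

  exit-of-child-of-b : ∀ {x} → Child x b → ∃[ y ] (InL G T x y × y ≢ b)
  exit-of-child-of-b (x≢r , refl) = InL-beyond-parent two-connected normal x≢r b≢r

  trapped⇒a∈L : ∀ {x} → Child x b → Trapped x → InL G T x a
  trapped⇒a∈L x↑b trapped with exit-of-child-of-b x↑b
  ... | y , y∈L , y≢b with trapped y y∈L
  ...   | inj₁ refl = y∈L
  ...   | inj₂ y≡b  = contradiction y≡b y≢b

  trapped⇒InD : ∀ {x} → Child x b → a ≼ b → Trapped x → InD x
  trapped⇒InD {x} x↑b a≼b trapped =
    x↑b , inj₁ (a∈L , a-lowest) , inj₁ (parent∈L x↑b , a , a∈L , (a≼b , a≢b) , b-next)
    where
    a∈L : InL G T x a
    a∈L = trapped⇒a∈L x↑b trapped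
    a-lowest : ∀ z → InL G T x z → a ≼ z
    a-lowest z z∈L with trapped z z∈L
    ... | inj₁ refl = here
    ... | inj₂ refl = a≼b
    b-next : ∀ z → InL G T x z → z ≡ a ⊎ b ≼ z
    b-next z z∈L with trapped z z∈L
    ... | inj₁ z≡a  = inj₁ z≡a
    ... | inj₂ refl = inj₂ here

  lwpt₁≡a∧b≤lwpt₂⇒trapped : ∀ {x l} → Child x b → Lwpt1 G T x a → Lwpt2 G T x l → b ≤ᵥ l → Trapped x
  lwpt₁≡a∧b≤lwpt₂⇒trapped x↑b (inj₂ (_ , a≡x)) _ _ =
    contradiction (subst (b ≼_) (sym a≡x) (child⇒≼ x↑b)) (<ᵥ⇒⋠ a<b)
  lwpt₁≡a∧b≤lwpt₂⇒trapped x↑b (inj₁ (a∈L , _)) (inj₂ (L-singleton , _)) _ z z∈L =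
    inj₁ (L-singleton z a z∈L a∈L)
  lwpt₁≡a∧b≤lwpt₂⇒trapped {l = l} x↑b (inj₁ (a∈L , _)) (inj₁ (_ , y , _ , _ , first-or-above)) b≤l z z∈L
    with first-or-above z z∈L | first-or-above a a∈L
  ... | _        | inj₂ l≼a = contradiction (≤-trans b≤l (≼⇒≤ᵥ l≼a)) (<⇒≱ a<b)
  ... | inj₁ z≡y | inj₁ a≡y = inj₁ (trans z≡y (sym a≡y))
  ... | inj₂ l≼z | inj₁ _   =
    inj₂ (Finₚ.≤-antisym (≼⇒≤ᵥ (InL⇒≼parent x↑b z∈L)) (≤-trans b≤l (≼⇒≤ᵥ l≼z)))

  InD⇒trapped : ∀ {x} → InD x → Trapped x
  InD⇒trapped (x↑b , lwpt₁≡a , lwpt₂≡b) = lwpt₁≡a∧b≤lwpt₂⇒trapped x↑b lwpt₁≡a lwpt₂≡b ≤-refl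

  trapped⇒b≤lwpt₂ : ∀ {x l} → Child x b → Trapped x → Lwpt2 G T x l → b ≤ᵥ l
  trapped⇒b≤lwpt₂ x↑b trapped (inj₂ (L-singleton , _)) =
    contradiction (L-singleton a b (trapped⇒a∈L x↑b trapped) (parent∈L x↑b)) a≢b
  trapped⇒b≤lwpt₂ x↑b trapped (inj₁ (l∈L , y , y∈L , (y≼l , y≢l) , _))
    with trapped _ l∈L | trapped y y∈L
  ... | inj₂ refl | _         = ≤-refl
  ... | inj₁ refl | inj₁ refl = contradiction refl y≢l
  ... | inj₁ refl | inj₂ refl = contradiction y≼l (<ᵥ⇒⋠ a<b)

  Conditions : Subset n → Subset n → Set
  Conditions A B =
    Σ (Fin n) (λ a′ → (Child a′ a × LeftmostDesc G T a′ b × a′ ≢ b)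
      × Σ ℕ (λ i → i ≤ k
          × (ShapeB G T A B a b a′ k c i ⊎ ShapeB G T B A a b a′ k c i)
          × (∀ (j : Fin k) → toℕ j < i → ∀ l → Lwpt1 G T (c j) l → a ≤ᵥ l)
          × (∀ (j : Fin k) → i ≤ toℕ j → ∀ h → Hgpt G T (c j) h → h ≤ᵥ a)
          × ¬ Σ (Fin k) (λ j → Σ (Fin k) (λ j′ → toℕ j < i × i ≤ toℕ j′ × InD (c j) × InD (c j′)))))
    × a ≢ r × Stable G T a b

  NonSeparator : Fin n → Set
  NonSeparator v = v ≢ a × v ≢ b

  interior-between : a ≼ b → ∀ {w} → InTreePathInterior G T a b w → a ≼ w × w ≼ b
  interior-between a≼b ((inj₁ w≼a , below-common) , w≢a , _) =
    contradiction (≼-antisym w≼a (below-common a here a≼b)) w≢a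
  interior-between a≼b ((inj₂ w≼b , below-common) , _) = below-common a here a≼b , w≼b

  adjacent-has-empty-interior : Child b a → ∀ {w} → ¬ InTreePathInterior G T a b w
  adjacent-has-empty-interior b↑a {w} w-interior@(_ , w≢a , w≢b) with interior-between (child⇒≼ b↑a) w-interior
  ... | a≼w , w≼b = w≢a (≼-antisym (subst (w ≼_) (proj₂ b↑a) (proj₁ (≼-parent w≼b w≢b))) a≼w)

  module Component (a′ : Fin n) (a′↑a : Child a′ a) (a′≼b : a′ ≼ b) (a′≢b : a′ ≢ b) where

    a≼b : a ≼ b
    a≼b = ≼-trans (child⇒≼ a′↑a) a′≼b

    a<a′ : a <ᵥ a′
    a<a′ = child⇒>ᵥ a′↑a

    b⋠a′ : ¬ b ≼ a′
    b⋠a′ b≼a′ = a′≢b (≼-antisym a′≼b b≼a′)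

    -- The component of T − {a, b} containing a′ is Desc(a′) ∖ Desc(b).
    T₂ : Fin n → Set
    T₂ v = a′ ≼ v × ¬ b ≼ v

    a′∈T₂ : T₂ a′
    a′∈T₂ = here , b⋠a′

    T₂⇒NonSeparator : ∀ {v} → T₂ v → NonSeparator v
    T₂⇒NonSeparator (a′≼v , b⋠v) =
      (λ v≡a → <ᵥ⇒⋠ a<a′ (subst (a′ ≼_) v≡a a′≼v)) , (λ v≡b → b⋠v (subst (b ≼_) (sym v≡b) here))

    tree-walk-stays-in-T₂ : ∀ {u v} → Walk (TreeEdge G T) NonSeparator u v → T₂ u → T₂ v
    tree-walk-stays-in-T₂ (stay _) u∈T₂ = u∈T₂
    tree-walk-stays-in-T₂ (step {u = u} _ (inj₁ (u≢r , refl)) rest) (a′≼u , b⋠u) with u ≟ᶠ a′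
    ... | yes refl = contradiction (proj₂ a′↑a) (proj₁ (walk-source rest))
    ... | no u≢a′ = tree-walk-stays-in-T₂ rest (proj₁ (≼-parent a′≼u (u≢a′ ∘ sym)) , b⋠u ∘ up u≢r)
    tree-walk-stays-in-T₂ (step _ (inj₂ (w≢r , refl)) rest) (a′≼u , b⋠u) =
      tree-walk-stays-in-T₂ rest
        (up w≢r a′≼u , λ b≼w → b⋠u (proj₁ (≼-parent b≼w (proj₂ (walk-source rest) ∘ sym))))

    component⇔T₂ : ∀ v → InComponentAvoiding G T a b a′ v ⟺ T₂ v
    component⇔T₂ v = (λ walk → tree-walk-stays-in-T₂ walk a′∈T₂) , λ v∈T₂ →
      walk-reverse tree-edge-sym (walk-up (proj₁ v∈T₂) λ z a′≼z z≼v →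
        T₂⇒NonSeparator (a′≼z , λ b≼z → proj₂ v∈T₂ (≼-trans b≼z z≼v)))

    T₂-or-below-a : ∀ {u w} → a′ ≼ w → u ≼ w → u ≢ a → ¬ b ≼ u → T₂ u ⊎ u <ᵥ a
    T₂-or-below-a {u} a′≼w u≼w u≢a b⋠u with ancestors-comparable a′≼w u≼w
    ... | inj₁ a′≼u = inj₁ (a′≼u , b⋠u)
    ... | inj₂ u≼a′ with u ≟ᶠ a′
    ...   | yes refl   = inj₁ a′∈T₂
    ...   | no  u≢a′ = inj₂ (≼∧≢⇒<ᵥ (subst (u ≼_) (proj₂ a′↑a) (proj₁ (≼-parent u≼a′ u≢a′))) u≢a)

    on-path-T₂-or-below-a : ∀ {u} → u ≼ b → u ≢ a → u ≢ b → T₂ u ⊎ u <ᵥ a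
    on-path-T₂-or-below-a u≼b u≢a u≢b = T₂-or-below-a a′≼b u≼b u≢a (λ b≼u → u≢b (≼-antisym u≼b b≼u))

    a′-interior : InTreePathInterior G T a b a′
    a′-interior = (inj₂ a′≼b , λ z z≼a _ → ≼-trans z≼a (child⇒≼ a′↑a)) , child≢parent a′↑a , a′≢b

    interior⇒T₂ : ∀ {w} → InTreePathInterior G T a b w → T₂ w
    interior⇒T₂ w-interior@(_ , w≢a , w≢b) with interior-between a≼b w-interior
    ... | a≼w , w≼b with on-path-T₂-or-below-a w≼b w≢a w≢b
    ...   | inj₁ w∈T₂ = w∈T₂
    ...   | inj₂ w<a  = contradiction a≼w (<ᵥ⇒⋠ w<a)

  Only : Subset n → Subset n → Fin n → Set
  Only X Y v = v ∈ X × v ∉ Y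

  spread-in-subtree : ∀ {Q : Fin n → Set} → (∀ {u v} → Q u → Edge G u v → NonSeparator v → Q v) →
                      ∀ {x u w} → (∀ z → x ≼ z → NonSeparator z) → Q u → x ≼ u → x ≼ w → Q w
  spread-in-subtree Q-closed subtree-free Qu x≼u x≼w =
    walk-transport Q-closed (walk-within _ x≼u x≼w subtree-free) Qu

  spread-to-L : ∀ {Q : Fin n → Set} → (∀ {u v} → Q u → Edge G u v → NonSeparator v → Q v) →
                ∀ {x u y} → (∀ z → x ≼ z → NonSeparator z) → Q u → x ≼ u → InL G T x y → NonSeparator y → Q y
  spread-to-L Q-closed subtree-free Qu x≼u (_ , w , x≼w , e) y-free =
    Q-closed (spread-in-subtree Q-closed subtree-free Qu x≼u x≼w) e y-free

  trapped-in-connected-side : ∀ {Q : Fin n → Set} → ConnectedOn (Edge G) Q → (∀ {v} → Q v → NonSeparator v) →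
                              ∀ {x t} → Trapped x → Q x → Q t → ¬ x ≼ t → ⊥
  trapped-in-connected-side connected Q⇒free {x} trapped Qx Qt x⋠t
    with subtree-exit normal (connected _ _ Qx Qt) here x⋠t
  ... | y , y∈L , Qy with trapped y y∈L
  ...   | inj₁ y≡a = proj₁ (Q⇒free Qy) y≡a
  ...   | inj₂ y≡b = proj₂ (Q⇒free Qy) y≡b

  module Sides (A B : Subset n) (separation : IsSeparation G T A B) (separator : HasSeparator G T A B a b) where

    sides-cover : ∀ {v} → NonSeparator v → Only A B v ⊎ Only B A v
    sides-cover {v} (v≢a , v≢b) with v ∈? A | v ∈? B
    ... | yes v∈A | yes v∈B with proj₁ (separator v) (v∈A , v∈B)
    ...   | inj₁ v≡a = contradiction v≡a v≢a
    ...   | inj₂ v≡b = contradiction v≡b v≢b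
    sides-cover (v≢a , v≢b) | yes v∈A | no v∉B = inj₁ (v∈A , v∉B)
    sides-cover (v≢a , v≢b) | no v∉A | yes v∈B = inj₂ (v∈B , v∉A)
    sides-cover {v} (v≢a , v≢b) | no v∉A | no v∉B with proj₁ separation v
    ... | inj₁ v∈A = contradiction v∈A v∉A
    ... | inj₂ v∈B = contradiction v∈B v∉B

    Only-A⇒NonSeparator : ∀ {v} → Only A B v → NonSeparator v
    Only-A⇒NonSeparator (_ , v∉B) =
      (λ { refl → v∉B (proj₂ (proj₂ (separator a) (inj₁ refl))) }) ,
      (λ { refl → v∉B (proj₂ (proj₂ (separator b) (inj₂ refl))) })

    Only-B⇒NonSeparator : ∀ {v} → Only B A v → NonSeparator v
    Only-B⇒NonSeparator (_ , v∉A) =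
      (λ { refl → v∉A (proj₁ (proj₂ (separator a) (inj₁ refl))) }) ,
      (λ { refl → v∉A (proj₁ (proj₂ (separator b) (inj₂ refl))) })

    Only-A-closed : ∀ {u v} → Only A B u → Edge G u v → NonSeparator v → Only A B v
    Only-A-closed (u∈A , u∉B) e v-free with sides-cover v-free
    ... | inj₁ v∈A∖B        = v∈A∖B
    ... | inj₂ (v∈B , v∉A) = contradiction e (proj₂ (proj₂ (proj₂ separation)) _ _ u∈A u∉B v∈B v∉A)

    Only-B-closed : ∀ {u v} → Only B A u → Edge G u v → NonSeparator v → Only B A v
    Only-B-closed (u∈B , u∉A) e v-free with sides-cover v-free
    ... | inj₁ (v∈A , v∉B) = contradiction (edge-sym e) (proj₂ (proj₂ (proj₂ separation)) _ _ v∈A v∉B u∈B u∉A)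
    ... | inj₂ v∈B∖A        = v∈B∖A

    A⇔not-only-B : ∀ v → v ∈ A ⟺ (¬ (v ∈ B × ¬ (v ≡ a ⊎ v ≡ b)))
    A⇔not-only-B v = (λ v∈A (v∈B , v∉ab) → v∉ab (proj₁ (separator v) (v∈A , v∈B))) , not-only-B⇒A
      where
      not-only-B⇒A : ¬ (v ∈ B × ¬ (v ≡ a ⊎ v ≡ b)) → v ∈ A
      not-only-B⇒A not-only-B with v ∈? A | proj₁ separation v
      ... | yes v∈A | _       = v∈A
      ... | no  _   | inj₁ v∈A = v∈A
      ... | no  v∉A | inj₂ v∈B = contradiction (v∈B , λ v∈ab → v∉A (proj₁ (proj₂ (separator v) v∈ab))) not-only-B

  module Sufficiency (A B : Subset n) (a′ : Fin n) (a′↑a : Child a′ a) (lm : LeftmostDesc G T a′ b)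
                     (a′≢b : a′ ≢ b) (i : ℕ) (shape : ShapeB G T A B a b a′ k c i)
                     (low : ∀ j → toℕ j < i → ∀ l → Lwpt1 G T (c j) l → a ≤ᵥ l)
                     (high : ∀ j → i ≤ toℕ j → ∀ h → Hgpt G T (c j) h → h ≤ᵥ a)
                     (no-split : ¬ Σ (Fin k) (λ j → Σ (Fin k) (λ j′ →
                                   toℕ j < i × i ≤ toℕ j′ × InD (c j) × InD (c j′))))
                     (a≢r : a ≢ r) (stable : Stable G T a b) where

    open Component a′ a′↑a (leftmost⇒≼ lm) a′≢b

    -- B ∖ A as described by condition (2).
    Inner : Fin n → Set
    Inner v = T₂ v ⊎ ∃[ j ] (toℕ j < i × c j ≼ v)

    Inner⇒NonSeparator : ∀ {v} → Inner v → NonSeparator v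
    Inner⇒NonSeparator (inj₁ v∈T₂)          = T₂⇒NonSeparator v∈T₂
    Inner⇒NonSeparator (inj₂ (j , _ , cj≼v)) = below-child-of-b-avoids (c↑b j) cj≼v

    Inner⇒B∖A : ∀ {v} → Inner v → v ∈ B × v ∉ A
    Inner⇒B∖A {v} v-inner = v∈B , λ v∈A → proj₁ (proj₂ (shape v)) v∈A (v∈B , v∉ab)
      where
      v∉ab : ¬ (v ≡ a ⊎ v ≡ b)
      v∉ab (inj₁ v≡a) = proj₁ (Inner⇒NonSeparator v-inner) v≡a
      v∉ab (inj₂ v≡b) = proj₂ (Inner⇒NonSeparator v-inner) v≡b
      v∈B : v ∈ B
      v∈B = proj₂ (proj₁ (shape v)) (inj₂ (inj₂ (map₁ (proj₂ (component⇔T₂ v)) v-inner)))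

    B⇒separator⊎Inner : ∀ {v} → v ∈ B → (v ≡ a ⊎ v ≡ b) ⊎ Inner v
    B⇒separator⊎Inner {v} v∈B with proj₁ (proj₁ (shape v)) v∈B
    ... | inj₁ v≡a                 = inj₁ (inj₁ v≡a)
    ... | inj₂ (inj₁ v≡b)          = inj₁ (inj₂ v≡b)
    ... | inj₂ (inj₂ (inj₁ walk))  = inj₂ (inj₁ (proj₁ (component⇔T₂ v) walk))
    ... | inj₂ (inj₂ (inj₂ low-v)) = inj₂ (inj₂ low-v)

    separator⇒A : ∀ {v} → v ≡ a ⊎ v ≡ b → v ∈ A
    separator⇒A {v} v∈ab = proj₂ (proj₂ (shape v)) (λ (_ , v∉ab) → v∉ab v∈ab)

    separator⇒B : ∀ {v} → v ≡ a ⊎ v ≡ b → v ∈ B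
    separator⇒B {v} (inj₁ v≡a) = proj₂ (proj₁ (shape v)) (inj₁ v≡a)
    separator⇒B {v} (inj₂ v≡b) = proj₂ (proj₁ (shape v)) (inj₂ (inj₁ v≡b))

    ∉B⇒NonSeparator : ∀ {v} → v ∉ B → NonSeparator v
    ∉B⇒NonSeparator v∉B = v∉B ∘ separator⇒B ∘ inj₁ , v∉B ∘ separator⇒B ∘ inj₂

    B∖A⇒Inner : ∀ {v} → v ∈ B → v ∉ A → Inner v
    B∖A⇒Inner v∈B v∉A with B⇒separator⊎Inner v∈B
    ... | inj₁ v∈ab    = contradiction (separator⇒A v∈ab) v∉A
    ... | inj₂ v-inner = v-inner

    Outer : Fin n → Set
    Outer v = ¬ Inner v × NonSeparator v

    Outer⇒A∖B : ∀ {v} → Outer v → v ∈ A × v ∉ B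
    Outer⇒A∖B {v} (v-outer , v≢a , v≢b) = proj₂ (proj₂ (shape v)) (v∉B ∘ proj₁) , v∉B
      where
      v∉B : v ∉ B
      v∉B v∈B with B⇒separator⊎Inner v∈B
      ... | inj₁ (inj₁ v≡a) = v≢a v≡a
      ... | inj₁ (inj₂ v≡b) = v≢b v≡b
      ... | inj₂ v-inner    = v-outer v-inner

    T₂⇒<ᵥb : ∀ {v} → T₂ v → v <ᵥ b
    T₂⇒<ᵥb {v} (a′≼v , b⋠v) with toℕ b ≤? toℕ v
    ... | yes b≤v = contradiction (leftmost-≤ᵥ⇒≼ lm a′≼v b≤v) b⋠v
    ... | no  b≰v = ≰⇒> b≰v

    low-L : ∀ {j z} → toℕ j < i → InL G T (c j) z → a ≤ᵥ z
    low-L {j} j<i z∈L = let l , lwpt = lwpt₁-exists (c j) in ≤-trans (low j j<i l lwpt) (lwpt₁≤L z∈L lwpt)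

    high-L : ∀ {j z} → i ≤ toℕ j → InL G T (c j) z → z ≢ b → z ≤ᵥ a
    high-L {j} i≤j z∈L z≢b =
      let h , hgpt = hgpt-exists (c j) in
      ≤-trans (L≤hgpt z∈L (λ z≡pcj → z≢b (trans z≡pcj (proj₂ (c↑b j)))) hgpt) (high j i≤j h hgpt)

    low-L-in-T₂ : ∀ {j z} → toℕ j < i → InL G T (c j) z → z ≢ a → z ≢ b → T₂ z
    low-L-in-T₂ {j} j<i z∈L z≢a z≢b with on-path-T₂-or-below-a (InL⇒≼parent (c↑b j) z∈L) z≢a z≢b
    ... | inj₁ z∈T₂ = z∈T₂
    ... | inj₂ z<a  = contradiction (low-L j<i z∈L) (<⇒≱ z<a)

    back-edges-below-a : ∀ {x y} → BackEdge G T x y → a′ ≤ᵥ x → x <ᵥ b → a ≤ᵥ y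
    back-edges-below-a = stable-back-edges stable a′↑a lm _ _

    -- By normality u is an ancestor or a descendant of v; stability excludes the first way out
    -- of B ∖ A and condition (5) the second.
    T₂-closed : ∀ {u v} → T₂ v → Edge G u v → NonSeparator u → Inner u
    T₂-closed {u} {v} (a′≼v , b⋠v) e (u≢a , u≢b) with normal u v e
    ... | inj₁ u≼v with T₂-or-below-a a′≼v u≼v u≢a (λ b≼u → b⋠v (≼-trans b≼u u≼v))
    ...   | inj₁ u∈T₂ = inj₁ u∈T₂
    ...   | inj₂ u<a  =
      contradiction (back-edges-below-a (edge-sym e , u≼v , not-tree-edge) (≼⇒≤ᵥ a′≼v) (T₂⇒<ᵥb (a′≼v , b⋠v)))
                    (<⇒≱ u<a)
      where
      not-tree-edge : ¬ TreeEdge G T v u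
      not-tree-edge (inj₁ (v≢r , refl)) with v ≟ᶠ a′
      ... | yes refl  = u≢a (proj₂ a′↑a)
      ... | no  v≢a′ = <ᵥ⇒⋠ (<-trans u<a a<a′) (proj₁ (≼-parent a′≼v (v≢a′ ∘ sym)))
      not-tree-edge (inj₂ u↑v) = ≤⇒≯ (≼⇒≤ᵥ a′≼v) (<-trans (child⇒>ᵥ u↑v) (<-trans u<a a<a′))
    T₂-closed {u} {v} (a′≼v , b⋠v) e (u≢a , u≢b) | inj₂ v≼u with b ≼? u
    ... | no  b⋠u = inj₁ (≼-trans a′≼v v≼u , b⋠u)
    ... | yes b≼u with below-b⇒below-child b≼u u≢b
    ...   | j , cj≼u with toℕ j <? i
    ...     | yes j<i = inj₂ (j , j<i , cj≼u)
    ...     | no  j≮i = contradiction (high-L (≮⇒≥ j≮i) v∈L v≢b) (<⇒≱ (<-≤-trans a<a′ (≼⇒≤ᵥ a′≼v)))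
      where
      cj⋠v : ¬ c j ≼ v
      cj⋠v cj≼v = b⋠v (≼-trans (child⇒≼ (c↑b j)) cj≼v)
      v≼cj : v ≼ c j
      v≼cj with ancestors-comparable v≼u cj≼u
      ... | inj₁ v≼cj = v≼cj
      ... | inj₂ cj≼v = contradiction cj≼v cj⋠v
      v∈L : InL G T (c j) v
      v∈L = (v≼cj , λ v≡cj → cj⋠v (subst (c j ≼_) (sym v≡cj) here)) , u , cj≼u , e
      v≢b : v ≢ b
      v≢b v≡b = b⋠v (subst (b ≼_) (sym v≡b) here)

    low-subtree-closed : ∀ {j u v} → toℕ j < i → c j ≼ v → Edge G u v → NonSeparator u → Inner u
    low-subtree-closed {j} {u} {v} j<i cj≼v e (u≢a , u≢b) with normal u v e
    ... | inj₂ v≼u = inj₂ (j , j<i , ≼-trans cj≼v v≼u)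
    ... | inj₁ u≼v with ancestors-comparable u≼v cj≼v
    ...   | inj₂ cj≼u = inj₂ (j , j<i , cj≼u)
    ...   | inj₁ u≼cj with u ≟ᶠ c j
    ...     | yes refl = inj₂ (j , j<i , here)
    ...     | no  u≢cj = inj₁ (low-L-in-T₂ j<i ((u≼cj , u≢cj) , v , cj≼v , edge-sym e) u≢a u≢b)

    Inner-closed : ∀ {u v} → Inner v → Edge G u v → NonSeparator u → Inner u
    Inner-closed (inj₁ v∈T₂)            = T₂-closed v∈T₂
    Inner-closed (inj₂ (_ , j<i , cj≼v)) = low-subtree-closed j<i cj≼v

    A∖B⇒Outer : ∀ {v} → v ∈ A → v ∉ B → Outer v
    A∖B⇒Outer v∈A v∉B = (λ v-inner → proj₂ (Inner⇒B∖A v-inner) v∈A) , ∉B⇒NonSeparator v∉B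

    r-outer : Outer r
    r-outer = r∉Inner , a≢r ∘ sym , b≢r ∘ sym
      where
      r∉Inner : ¬ Inner r
      r∉Inner (inj₁ (a′≼r , _))    = proj₁ a′↑a (≼-r⇒≡r a′≼r)
      r∉Inner (inj₂ (j , _ , cj≼r)) = proj₁ (c↑b j) (≼-r⇒≡r cj≼r)

    is-separation : IsSeparation G T A B
    is-separation = cover , (r , Outer⇒A∖B r-outer) , (a′ , Inner⇒B∖A (inj₁ a′∈T₂)) , no-edge
      where
      cover : ∀ v → v ∈ A ⊎ v ∈ B
      cover v with v ∈? B
      ... | yes v∈B = inj₂ v∈B
      ... | no  v∉B = inj₁ (proj₂ (proj₂ (shape v)) (v∉B ∘ proj₁))
      no-edge : ∀ u v → u ∈ A → u ∉ B → v ∈ B → v ∉ A → ¬ Edge G u v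
      no-edge u v _ u∉B v∈B v∉A e =
        u∉B (proj₁ (Inner⇒B∖A (Inner-closed (B∖A⇒Inner v∈B v∉A) e (∉B⇒NonSeparator u∉B))))

    has-separator : HasSeparator G T A B a b
    has-separator v = A∩B⇒separator , λ v∈ab → separator⇒A v∈ab , separator⇒B v∈ab
      where
      A∩B⇒separator : v ∈ A × v ∈ B → v ≡ a ⊎ v ≡ b
      A∩B⇒separator (v∈A , v∈B) = decidable-stable ((v ≟ᶠ a) ⊎-dec (v ≟ᶠ b))
                                    (λ v∉ab → proj₁ (proj₂ (shape v)) v∈A (v∈B , v∉ab))

    Inner-connected : (∀ j → toℕ j < i → Escapes (c j)) → ConnectedOn (Edge G) Inner
    Inner-connected low-escape = connected-through edge-sym to-a′
      where
      T₂-to-a′ : ∀ {u} → T₂ u → Walk (Edge G) Inner u a′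
      T₂-to-a′ (a′≼u , b⋠u) =
        walk-map tree-edge⇒edge inj₁
          (walk-up a′≼u λ z a′≼z z≼u → a′≼z , λ b≼z → b⋠u (≼-trans b≼z z≼u))
      to-a′ : ∀ {u} → Inner u → Walk (Edge G) Inner u a′
      to-a′ (inj₁ u∈T₂) = T₂-to-a′ u∈T₂
      to-a′ (inj₂ (j , j<i , cj≼u)) with low-escape j j<i
      ... | z , z∈L@(_ , w , cj≼w , e) , z≢a , z≢b =
        walk-++ (walk-within (c j) cj≼u cj≼w λ x cj≼x → inj₂ (j , j<i , cj≼x))
                (step (inj₂ (j , j<i , cj≼w)) e (T₂-to-a′ (low-L-in-T₂ j<i z∈L z≢a z≢b)))

    ⋡a⇒Outer : ∀ {z} → ¬ a ≼ z → Outer z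
    ⋡a⇒Outer {z} a⋠z =
      z∉Inner , (λ z≡a → a⋠z (subst (a ≼_) (sym z≡a) here)) , (λ z≡b → a⋠z (subst (a ≼_) (sym z≡b) a≼b))
      where
      z∉Inner : ¬ Inner z
      z∉Inner (inj₁ (a′≼z , _))    = a⋠z (≼-trans (child⇒≼ a′↑a) a′≼z)
      z∉Inner (inj₂ (j , _ , cj≼z)) = a⋠z (≼-trans a≼b (≼-trans (child⇒≼ (c↑b j)) cj≼z))

    outside-a-to-root : ∀ {u} → ¬ a ≼ u → Walk (Edge G) Outer u r
    outside-a-to-root a⋠u =
      walk-map tree-edge⇒edge id
               (walk-up (r≼ _) λ z _ z≼u → ⋡a⇒Outer (λ a≼z → a⋠u (≼-trans a≼z z≼u)))

    escape-to-root : ∀ {x y} → (∀ z → x ≼ z → Outer z) → InL G T x y → ¬ a ≼ y →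
                     ∀ {u} → x ≼ u → Walk (Edge G) Outer u r
    escape-to-root subtree-outer (_ , w , x≼w , e) a⋠y x≼u =
      walk-++ (walk-within _ x≼u x≼w subtree-outer) (step (subtree-outer w x≼w) e (outside-a-to-root a⋠y))

    other-branch-outer : ∀ {x z} → Child x a → x ≢ a′ → x ≼ z → Outer z
    other-branch-outer {x} {z} x↑a x≢a′ x≼z =
      z∉Inner , (λ z≡a → <ᵥ⇒⋠ (child⇒>ᵥ x↑a) (subst (x ≼_) z≡a x≼z)) ,
      (λ z≡b → x≢a′ (siblings-with-common-descendant x↑a a′↑a (subst (x ≼_) z≡b x≼z) (leftmost⇒≼ lm)))
      where
      z∉Inner : ¬ Inner z
      z∉Inner (inj₁ (a′≼z , _))    = x≢a′ (siblings-with-common-descendant x↑a a′↑a x≼z a′≼z)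
      z∉Inner (inj₂ (j , _ , cj≼z)) =
        x≢a′ (siblings-with-common-descendant x↑a a′↑a x≼z
                (≼-trans (leftmost⇒≼ lm) (≼-trans (child⇒≼ (c↑b j)) cj≼z)))

    high-subtree-outer : ∀ {j z} → i ≤ toℕ j → c j ≼ z → Outer z
    high-subtree-outer {j} {z} i≤j cj≼z = z∉Inner , below-child-of-b-avoids (c↑b j) cj≼z
      where
      z∉Inner : ¬ Inner z
      z∉Inner (inj₁ (_ , b⋠z)) = b⋠z (≼-trans (child⇒≼ (c↑b j)) cj≼z)
      z∉Inner (inj₂ (j′ , j′<i , cj′≼z)) with ancestors-comparable cj≼z cj′≼z
      ... | inj₁ cj≼cj′ =
        <-irrefl (sym (c-injective (siblings-nested⇒≡ (c↑b j) (c↑b j′) cj≼cj′))) (<-≤-trans j′<i i≤j)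
      ... | inj₂ cj′≼cj =
        <-irrefl (c-injective (siblings-nested⇒≡ (c↑b j′) (c↑b j) cj′≼cj)) (<-≤-trans j′<i i≤j)

    other-branch-to-root : ∀ {x u} → Child x a → x ≢ a′ → x ≼ u → Walk (Edge G) Outer u r
    other-branch-to-root x↑a x≢a′ x≼u
      with InL-beyond-parent two-connected normal (proj₁ x↑a) (a≢r ∘ trans (sym (proj₂ x↑a)))
    ... | y , y∈L , y≢px =
      escape-to-root (λ _ → other-branch-outer x↑a x≢a′) y∈L
                     (λ a≼y → y≢px (trans (≼-antisym (InL⇒≼parent x↑a y∈L) a≼y) (sym (proj₂ x↑a)))) x≼u

    high-branch-to-root : (∀ j → i ≤ toℕ j → Escapes (c j)) →
                          ∀ {u} → a′ ≼ u → Outer u → Walk (Edge G) Outer u r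
    high-branch-to-root high-escape {u} a′≼u u-outer
      with below-b⇒below-child (decidable-stable (b ≼? u) λ b⋠u → proj₁ u-outer (inj₁ (a′≼u , b⋠u)))
                               (proj₂ (proj₂ u-outer))
    ... | j , cj≼u with toℕ j <? i
    ...   | yes j<i = contradiction (inj₂ (j , j<i , cj≼u)) (proj₁ u-outer)
    ...   | no  j≮i with high-escape j (≮⇒≥ j≮i)
    ...     | z , z∈L , z≢a , z≢b =
      escape-to-root (λ _ → high-subtree-outer (≮⇒≥ j≮i)) z∈L
                     (λ a≼z → z≢a (Finₚ.≤-antisym (high-L (≮⇒≥ j≮i) z∈L z≢b) (≼⇒≤ᵥ a≼z))) cj≼u

    Outer-connected : (∀ j → i ≤ toℕ j → Escapes (c j)) → ConnectedOn (Edge G) Outer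
    Outer-connected high-escape = connected-through edge-sym to-root
      where
      to-root : ∀ {u} → Outer u → Walk (Edge G) Outer u r
      to-root {u} u-outer with a ≼? u
      ... | no  a⋠u = outside-a-to-root a⋠u
      ... | yes a≼u with child-on-path a≼u (proj₁ (proj₂ u-outer) ∘ sym)
      ...   | x , x↑a , x≼u with x ≟ᶠ a′
      ...     | no  x≢a′ = other-branch-to-root x↑a x≢a′ x≼u
      ...     | yes refl = high-branch-to-root high-escape x≼u u-outer

    -- A trapped child below i and a trapped child from i on would both lie in 𝒟, against (6).
    half-connected : HalfConnected G T A B
    half-connected with any? (λ j → (toℕ j <? i) ×-dec ¬? (Escapes? (c j)))
    ... | no no-stuck-low =
      inj₂ (connected-on-⇔ Inner⇒B∖A (λ (v∈B , v∉A) → B∖A⇒Inner v∈B v∉A)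
              (Inner-connected λ j j<i → decidable-stable (Escapes? (c j)) (λ stuck → no-stuck-low (j , j<i , stuck))))
    ... | yes (j₀ , j₀<i , j₀-stuck) =
      inj₁ (connected-on-⇔ Outer⇒A∖B (λ (v∈A , v∉B) → A∖B⇒Outer v∈A v∉B)
              (Outer-connected λ j i≤j → decidable-stable (Escapes? (c j)) λ stuck →
                no-split (j₀ , j , j₀<i , i≤j , trapped⇒InD′ j₀ j₀-stuck , trapped⇒InD′ j stuck)))
      where
      trapped⇒InD′ : ∀ j → ¬ Escapes (c j) → InD (c j)
      trapped⇒InD′ j stuck = trapped⇒InD (c↑b j) a≼b (¬escapes⇒trapped stuck)

    type-2 : Type2 G T A B a b
    type-2 = a≢r ∘ sym , b≢r ∘ sym , (a′ , a′-interior) ,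
             inj₁ (Outer⇒A∖B r-outer , λ w w-interior → Inner⇒B∖A (inj₁ (interior⇒T₂ w-interior)))

    half-connected-type-2 : HalfConnType2SepWith G T A B a b
    half-connected-type-2 = is-separation , has-separator , half-connected , type-2

  module Necessity (A B : Subset n) (sep : HalfConnType2SepWith G T A B a b)
                   (orientation : Only A B r × (∀ w → InTreePathInterior G T a b w → Only B A w)) where

    has-separator : HasSeparator G T A B a b
    has-separator = proj₁ (proj₂ sep)

    open Sides A B (proj₁ sep) has-separator

    r∈A∖B : Only A B r
    r∈A∖B = proj₁ orientation

    interior⊆B∖A : ∀ w → InTreePathInterior G T a b w → Only B A w
    interior⊆B∖A = proj₂ orientation

    half-connected : HalfConnected G T A B
    half-connected = proj₁ (proj₂ (proj₂ sep))

    a≢r : a ≢ r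
    a≢r a≡r = proj₁ (proj₂ (proj₂ (proj₂ sep))) (sym a≡r)

    B∖A-has-separator-above : ∀ {v} → Only B A v → ∃[ z ] (z ≼ v × (z ≡ a ⊎ z ≡ b))
    B∖A-has-separator-above {v} v∈B∖A =
      decidable-stable (any? λ z → (z ≼? v) ×-dec ((z ≟ᶠ a) ⊎-dec (z ≟ᶠ b))) λ none →
        proj₂ (walk-transport Only-B-closed (root-path none) v∈B∖A) (proj₁ r∈A∖B)
      where
      root-path : ¬ (∃[ z ] (z ≼ v × (z ≡ a ⊎ z ≡ b))) → Walk (Edge G) NonSeparator v r
      root-path none = walk-map tree-edge⇒edge id (walk-up (r≼ v) λ z _ z≼v →
        (λ z≡a → none (z , z≼v , inj₁ z≡a)) , (λ z≡b → none (z , z≼v , inj₂ z≡b)))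

    interior-vertex : ∃ (InTreePathInterior G T a b)
    interior-vertex = proj₁ (proj₂ (proj₂ (proj₂ (proj₂ (proj₂ sep)))))

    a≼b : a ≼ b
    a≼b with interior-vertex
    ... | w , w-interior@((w≼a⊎w≼b , _) , w≢a , w≢b)
      with B∖A-has-separator-above (interior⊆B∖A w w-interior) | w≼a⊎w≼b
    ...   | z , a≼w , inj₁ refl | inj₂ w≼b = ≼-trans a≼w w≼b
    ...   | z , a≼w , inj₁ refl | inj₁ w≼a = contradiction (≼-antisym w≼a a≼w) w≢a
    ...   | z , b≼w , inj₂ refl | inj₁ w≼a = contradiction (≼-trans b≼w w≼a) (<ᵥ⇒⋠ a<b)
    ...   | z , b≼w , inj₂ refl | inj₂ w≼b = contradiction (≼-antisym w≼b b≼w) w≢b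

    a′ : Fin n
    a′ = proj₁ (child-on-path a≼b a≢b)

    a′↑a : Child a′ a
    a′↑a = proj₁ (proj₂ (child-on-path a≼b a≢b))

    a′≼b : a′ ≼ b
    a′≼b = proj₂ (proj₂ (child-on-path a≼b a≢b))

    a′≢b : a′ ≢ b
    a′≢b a′≡b = adjacent-has-empty-interior (subst (λ x → Child x a) a′≡b a′↑a) (proj₂ interior-vertex)

    open Component a′ a′↑a a′≼b a′≢b hiding (a≼b)

    a′∈B∖A : Only B A a′
    a′∈B∖A = interior⊆B∖A a′ a′-interior

    B∖A⇒a≼ : ∀ {v} → Only B A v → a ≼ v
    B∖A⇒a≼ v∈B∖A with B∖A-has-separator-above v∈B∖A
    ... | _ , a≼v , inj₁ refl = a≼v
    ... | _ , b≼v , inj₂ refl = ≼-trans a≼b b≼v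

    T₂⇒B∖A : ∀ {v} → T₂ v → Only B A v
    T₂⇒B∖A {v} v∈T₂ =
      walk-transport Only-B-closed (walk-map tree-edge⇒edge id (proj₂ (component⇔T₂ v) v∈T₂)) a′∈B∖A

    other-branch-free : ∀ {x z} → Child x a → x ≢ a′ → x ≼ z → NonSeparator z
    other-branch-free {x} x↑a x≢a′ x≼z =
      (λ z≡a → <ᵥ⇒⋠ (child⇒>ᵥ x↑a) (subst (x ≼_) z≡a x≼z)) ,
      (λ z≡b → x≢a′ (siblings-with-common-descendant x↑a a′↑a (subst (x ≼_) z≡b x≼z) a′≼b))

    below-a⇒NonSeparator : ∀ {y} → y ≼ a → y ≢ a → NonSeparator y
    below-a⇒NonSeparator y≼a y≢a = y≢a , λ y≡b → <ᵥ⇒⋠ a<b (subst (_≼ a) y≡b y≼a)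

    B∖A⇒a′≼ : ∀ {v} → Only B A v → a′ ≼ v
    B∖A⇒a′≼ {v} v∈B∖A with child-on-path (B∖A⇒a≼ v∈B∖A) (proj₁ (Only-B⇒NonSeparator v∈B∖A) ∘ sym)
    ... | x , x↑a , x≼v with x ≟ᶠ a′
    ...   | yes refl = x≼v
    ...   | no x≢a′ with InL-beyond-parent two-connected normal (proj₁ x↑a) (a≢r ∘ trans (sym (proj₂ x↑a)))
    ...     | y , y∈L , y≢px = contradiction (B∖A⇒a≼ y∈B∖A) (λ a≼y → y≢a (≼-antisym y≼a a≼y))
      where
      y≼a : y ≼ a
      y≼a = InL⇒≼parent x↑a y∈L
      y≢a : y ≢ a
      y≢a y≡a = y≢px (trans y≡a (sym (proj₂ x↑a)))
      y∈B∖A : Only B A y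
      y∈B∖A = spread-to-L Only-B-closed (λ _ → other-branch-free x↑a x≢a′) v∈B∖A x≼v y∈L
                          (below-a⇒NonSeparator y≼a y≢a)

    c-subtree-free : ∀ j z → c j ≼ z → NonSeparator z
    c-subtree-free j z = below-child-of-b-avoids (c↑b j)

    A∖B-child-L≤a : ∀ {j z} → Only A B (c j) → InL G T (c j) z → z ≢ b → z ≤ᵥ a
    A∖B-child-L≤a {j} {z} cj∈A∖B z∈L z≢b with z ≟ᶠ a
    ... | yes refl = ≤-refl
    ... | no z≢a with on-path-T₂-or-below-a (InL⇒≼parent (c↑b j) z∈L) z≢a z≢b
    ...   | inj₂ z<a  = <⇒≤ z<a
    ...   | inj₁ z∈T₂ = contradiction (T₂⇒B∖A z∈T₂)
                          (λ (_ , z∉A) → z∉A (proj₁ (spread-to-L Only-A-closed (c-subtree-free j)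
                                                                   cj∈A∖B here z∈L (z≢a , z≢b))))

    B∖A-subtree-L : ∀ {x z} → (∀ w → x ≼ w → NonSeparator w) → Only B A x → InL G T x z → a ≼ z
    B∖A-subtree-L {x} {z} subtree-free x∈B∖A z∈L with z ≟ᶠ a | z ≟ᶠ b
    ... | yes refl | _        = here
    ... | no  _    | yes refl = a≼b
    ... | no  z≢a  | no  z≢b  = B∖A⇒a≼ (spread-to-L Only-B-closed subtree-free x∈B∖A here z∈L (z≢a , z≢b))

    B∖A-child⇒a≤lwpt₁ : ∀ {j l} → Only B A (c j) → Lwpt1 G T (c j) l → a ≤ᵥ l
    B∖A-child⇒a≤lwpt₁ cj∈B∖A (inj₁ (l∈L , _)) = ≼⇒≤ᵥ (B∖A-subtree-L (c-subtree-free _) cj∈B∖A l∈L)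
    B∖A-child⇒a≤lwpt₁ {j} _ (inj₂ (_ , refl))   = <⇒≤ (<-trans a<b (b<c j))

    A∖B-child⇒lwpt₁≤a : ∀ {j l} → Only A B (c j) → Lwpt1 G T (c j) l → l ≤ᵥ a
    A∖B-child⇒lwpt₁≤a {j} cj∈A∖B lwpt with exit-of-child-of-b (c↑b j)
    ... | y , y∈L , y≢b = ≤-trans (lwpt₁≤L y∈L lwpt) (A∖B-child-L≤a cj∈A∖B y∈L y≢b)

    A∖B-child-lwpt₁≡a⇒trapped : ∀ {j} → Only A B (c j) → Lwpt1 G T (c j) a → Trapped (c j)
    A∖B-child-lwpt₁≡a⇒trapped {j} _ (inj₂ (_ , a≡cj)) = contradiction (b<c j) (<⇒≯ (subst (_<ᵥ b) a≡cj a<b))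
    A∖B-child-lwpt₁≡a⇒trapped cj∈A∖B (inj₁ (_ , a-lowest)) z z∈L with z ≟ᶠ b
    ... | yes z≡b = inj₂ z≡b
    ... | no  z≢b = inj₁ (Finₚ.≤-antisym (A∖B-child-L≤a cj∈A∖B z∈L z≢b) (≼⇒≤ᵥ (a-lowest z z∈L)))

    -- Whichever side is connected, a trapped child of b on that side could not reach the rest of it.
    not-both-trapped : ∀ {j j′} → Only B A (c j) → Only A B (c j′) → Trapped (c j) → Trapped (c j′) → ⊥
    not-both-trapped {j} {j′} cj∈B∖A cj′∈A∖B cj-trapped cj′-trapped with half-connected
    ... | inj₁ A∖B-connected =
      trapped-in-connected-side A∖B-connected Only-A⇒NonSeparator cj′-trapped cj′∈A∖B r∈A∖B
        (proj₁ (c↑b j′) ∘ ≼-r⇒≡r)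
    ... | inj₂ B∖A-connected =
      trapped-in-connected-side B∖A-connected Only-B⇒NonSeparator cj-trapped cj∈B∖A a′∈B∖A
        (λ cj≼a′ → ≤⇒≯ (≤-trans (≼⇒≤ᵥ cj≼a′) (≼⇒≤ᵥ a′≼b)) (b<c j))

    -- By compatibility, lwpt₁(c j) ≤ a ≤ lwpt₁(c j′) forces lwpt₁ = a on both children and
    -- lwpt₂(c j′) ≥ lwpt₂(c j) = b, which traps both of them.
    A∖B-child-before-B∖A-child : ∀ {j j′} → toℕ j < toℕ j′ → Only A B (c j) → Only B A (c j′) → ⊥
    A∖B-child-before-B∖A-child {j} {j′} j<j′ cj∈A∖B cj′∈B∖A
      with lwpt₁-exists (c j) | lwpt₂-exists (c j) | lwpt₁-exists (c j′) | lwpt₂-exists (c j′)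
    ... | l₁ , lw₁ | l₂ , lw₂ | m₁ , mw₁ | m₂ , mw₂
      with proj₂ compatible (c j) (c j′) (proj₁ (c↑b j)) (proj₁ (c↑b j′))
                 (trans (proj₂ (c↑b j)) (sym (proj₂ (c↑b j′)))) (c-increasing j j′ j<j′)
                 l₁ l₂ m₁ m₂ lw₁ lw₂ mw₁ mw₂
    ... | inj₁ m₁<l₁ =
      ≤⇒≯ (≤-trans (A∖B-child⇒lwpt₁≤a cj∈A∖B lw₁) (B∖A-child⇒a≤lwpt₁ cj′∈B∖A mw₁)) m₁<l₁
    ... | inj₂ (refl , l₂≤m₂) = not-both-trapped cj′∈B∖A cj∈A∖B cj′-trapped cj-trapped
      where
      l₁≡a : l₁ ≡ a
      l₁≡a = Finₚ.≤-antisym (A∖B-child⇒lwpt₁≤a cj∈A∖B lw₁) (B∖A-child⇒a≤lwpt₁ cj′∈B∖A mw₁)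
      cj-trapped : Trapped (c j)
      cj-trapped = A∖B-child-lwpt₁≡a⇒trapped cj∈A∖B (subst (Lwpt1 G T (c j)) l₁≡a lw₁)
      cj′-trapped : Trapped (c j′)
      cj′-trapped = lwpt₁≡a∧b≤lwpt₂⇒trapped (c↑b j′) (subst (Lwpt1 G T (c j′)) l₁≡a mw₁) mw₂
                      (≤-trans (trapped⇒b≤lwpt₂ (c↑b j) cj-trapped lw₂) l₂≤m₂)

    c-side : ∀ j → Only A B (c j) ⊎ Only B A (c j)
    c-side j = sides-cover (c-subtree-free j (c j) here)

    cut : ∃[ i ] (i ≤ k × (∀ j → toℕ j < i → Only B A (c j)) × (∀ j → toℕ j ≡ i → ¬ Only B A (c j)))
    cut = longest-prefix λ j → (c j ∈? B) ×-dec ¬? (c j ∈? A)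

    i : ℕ
    i = proj₁ cut

    below-cut-B∖A : ∀ j → toℕ j < i → Only B A (c j)
    below-cut-B∖A = proj₁ (proj₂ (proj₂ cut))

    at-cut-A∖B : ∀ j → toℕ j ≡ i → Only A B (c j)
    at-cut-A∖B j j≡i with c-side j
    ... | inj₁ cj∈A∖B = cj∈A∖B
    ... | inj₂ cj∈B∖A = contradiction cj∈B∖A (proj₂ (proj₂ (proj₂ cut)) j j≡i)

    from-cut-A∖B : ∀ j → i ≤ toℕ j → Only A B (c j)
    from-cut-A∖B j i≤j with c-side j | m≤n⇒m<n∨m≡n i≤j
    ... | inj₁ cj∈A∖B | _       = cj∈A∖B
    ... | inj₂ _      | inj₂ i≡j = at-cut-A∖B j (sym i≡j)
    ... | inj₂ cj∈B∖A | inj₁ i<j =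
      ⊥-elim (A∖B-child-before-B∖A-child (subst (_< toℕ j) (sym (toℕ-fromℕ< i<k)) i<j)
                                        (at-cut-A∖B (fromℕ< i<k) (toℕ-fromℕ< i<k)) cj∈B∖A)
      where
      i<k : i < k
      i<k = <-trans i<j (toℕ<n j)

    B∖A-child⇒below-cut : ∀ {j} → Only B A (c j) → toℕ j < i
    B∖A-child⇒below-cut {j} (_ , cj∉A) with toℕ j <? i
    ... | yes j<i = j<i
    ... | no  j≮i = contradiction (proj₁ (from-cut-A∖B j (≮⇒≥ j≮i))) cj∉A

    shape : ShapeB G T A B a b a′ k c i
    shape v = (B⇒described , described⇒B) , A⇔not-only-B v
      where
      B⇒described : v ∈ B → v ≡ a ⊎ v ≡ b ⊎ InComponentAvoiding G T a b a′ v
                                   ⊎ Σ (Fin k) (λ j → toℕ j < i × c j ≼ v)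
      B⇒described v∈B with v ≟ᶠ a | v ≟ᶠ b
      ... | yes v≡a | _       = inj₁ v≡a
      ... | no  _   | yes v≡b = inj₂ (inj₁ v≡b)
      ... | no  v≢a | no  v≢b with sides-cover (v≢a , v≢b) | b ≼? v
      ...   | inj₁ (_ , v∉B) | _       = contradiction v∈B v∉B
      ...   | inj₂ v∈B∖A     | no  b⋠v =
        inj₂ (inj₂ (inj₁ (proj₂ (component⇔T₂ v) (B∖A⇒a′≼ v∈B∖A , b⋠v))))
      ...   | inj₂ v∈B∖A     | yes b≼v with below-b⇒below-child b≼v v≢b
      ...     | j , cj≼v = inj₂ (inj₂ (inj₂ (j , B∖A-child⇒below-cut cj∈B∖A , cj≼v)))
        where
        cj∈B∖A : Only B A (c j)
        cj∈B∖A = spread-in-subtree Only-B-closed (c-subtree-free j) v∈B∖A cj≼v here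
      described⇒B : v ≡ a ⊎ v ≡ b ⊎ InComponentAvoiding G T a b a′ v
                      ⊎ Σ (Fin k) (λ j → toℕ j < i × c j ≼ v) → v ∈ B
      described⇒B (inj₁ v≡a)                        = proj₂ (proj₂ (has-separator v) (inj₁ v≡a))
      described⇒B (inj₂ (inj₁ v≡b))                 = proj₂ (proj₂ (has-separator v) (inj₂ v≡b))
      described⇒B (inj₂ (inj₂ (inj₁ walk)))         = proj₁ (T₂⇒B∖A (proj₁ (component⇔T₂ v) walk))
      described⇒B (inj₂ (inj₂ (inj₂ (j , j<i , cj≼v)))) =
        proj₁ (spread-in-subtree Only-B-closed (c-subtree-free j) (below-cut-B∖A j j<i) here cj≼v)

    lwpt₁-below-cut : ∀ j → toℕ j < i → ∀ l → Lwpt1 G T (c j) l → a ≤ᵥ l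
    lwpt₁-below-cut j j<i l = B∖A-child⇒a≤lwpt₁ (below-cut-B∖A j j<i)

    hgpt-from-cut : ∀ j → i ≤ toℕ j → ∀ h → Hgpt G T (c j) h → h ≤ᵥ a
    hgpt-from-cut j i≤j h (inj₁ (h∈L , h≢p , _)) =
      A∖B-child-L≤a (from-cut-A∖B j i≤j) h∈L (λ h≡b → h≢p (trans h≡b (sym (proj₂ (c↑b j)))))
    hgpt-from-cut j i≤j h (inj₂ (L⊆parent , _)) with exit-of-child-of-b (c↑b j)
    ... | y , y∈L , y≢b = contradiction (trans (L⊆parent y y∈L) (proj₂ (c↑b j))) y≢b

    no-split : ¬ Σ (Fin k) (λ j → Σ (Fin k) (λ j′ → toℕ j < i × i ≤ toℕ j′ × InD (c j) × InD (c j′)))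
    no-split (j , j′ , j<i , i≤j′ , cj∈D , cj′∈D) =
      not-both-trapped (below-cut-B∖A j j<i) (from-cut-A∖B j′ i≤j′) (InD⇒trapped cj∈D) (InD⇒trapped cj′∈D)

    -- An edge from Desc(a′) to a proper ancestor y of a must start below b: otherwise it would join
    -- B ∖ A to y ∈ A ∖ B.
    edge-from-below-b-over-a : ∃[ y ] ∃[ w ] (y ≼ a × y ≢ a × b ≼ w × Edge G w y)
    edge-from-below-b-over-a
      with InL-beyond-parent two-connected normal (proj₁ a′↑a) (a≢r ∘ trans (sym (proj₂ a′↑a)))
    ... | y , y∈L@(_ , w , a′≼w , e) , y≢pa′ = y , w , y≼a , y≢a , b≼w , e
      where
      y≼a : y ≼ a
      y≼a = InL⇒≼parent a′↑a y∈L
      y≢a : y ≢ a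
      y≢a y≡a = y≢pa′ (trans y≡a (sym (proj₂ a′↑a)))
      y∈A∖B : Only A B y
      y∈A∖B with sides-cover (below-a⇒NonSeparator y≼a y≢a)
      ... | inj₁ y∈A∖B = y∈A∖B
      ... | inj₂ y∈B∖A = contradiction (≼-antisym y≼a (B∖A⇒a≼ y∈B∖A)) y≢a
      b≼w : b ≼ w
      b≼w = decidable-stable (b ≼? w) λ b⋠w →
        proj₂ (Only-B-closed (T₂⇒B∖A (a′≼w , b⋠w)) e (below-a⇒NonSeparator y≼a y≢a)) (proj₁ y∈A∖B)

    L-of-path-vertex : ∀ {v y w} → a′ ≼ v → v ≼ b → y ≼ a → y ≢ a → b ≼ w → Edge G w y → InL G T v y
    L-of-path-vertex a′≼v v≼b y≼a y≢a b≼w e =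
      (≼-trans y≼a (≼-trans (child⇒≼ a′↑a) a′≼v) ,
       λ { refl → <ᵥ⇒⋠ (<-trans (≼∧≢⇒<ᵥ y≼a y≢a) a<a′) a′≼v }) ,
      _ , ≼-trans v≼b b≼w , e

    lwpt₁-on-path<a : ∀ {v l} → a′ ≼ v → v ≼ b → Lwpt1 G T v l → l <ᵥ a
    lwpt₁-on-path<a a′≼v v≼b lwpt =
      let y , w , y≼a , y≢a , b≼w , e = edge-from-below-b-over-a in
      ≤-<-trans (lwpt₁≤L (L-of-path-vertex a′≼v v≼b y≼a y≢a b≼w e) lwpt) (≼∧≢⇒<ᵥ y≼a y≢a)

    off-path-T₂-a≤lwpt₁ : ∀ {x l} → T₂ x → ¬ x ≼ b → Lwpt1 G T x l → a ≤ᵥ l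
    off-path-T₂-a≤lwpt₁ {x} x∈T₂ x⋠b (inj₁ (l∈L , _)) =
      ≼⇒≤ᵥ (B∖A-subtree-L subtree-free (T₂⇒B∖A x∈T₂) l∈L)
      where
      subtree-free : ∀ z → x ≼ z → NonSeparator z
      subtree-free z x≼z = (λ z≡a → <ᵥ⇒⋠ a<a′ (subst (a′ ≼_) z≡a (≼-trans (proj₁ x∈T₂) x≼z))) ,
                           (λ z≡b → x⋠b (subst (x ≼_) z≡b x≼z))
    off-path-T₂-a≤lwpt₁ (a′≼x , _) _ (inj₂ (_ , refl)) = <⇒≤ (<-≤-trans a<a′ (≼⇒≤ᵥ a′≼x))

    -- A larger sibling c′ of a path vertex v lies in T₂ off the path, so lwpt₁(c′) ≥ a > lwpt₁(v),
    -- contradicting compatibility.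
    on-path-left-child : ∀ {v} → v ≢ r → a′ ≼ p v → v ≼ b → IsLeftChild G T (p v) v
    on-path-left-child {v} v≢r a′≼pv v≼b = (v≢r , refl) , largest
      where
      largest : ∀ c′ → Child c′ (p v) → c′ ≤ᵥ v
      largest c′ c′↑pv = decidable-stable (toℕ c′ ≤? toℕ v) λ c′≰v →
        let v<c′ = ≰⇒> c′≰v
            v≢c′ = λ v≡c′ → Finₚ.<-irrefl v≡c′ v<c′
            b⋠c′ = λ b≼c′ → v≢c′ (siblings-nested⇒≡ (v≢r , refl) c′↑pv (≼-trans v≼b b≼c′))
            c′⋠b = λ c′≼b → v≢c′ (siblings-with-common-descendant (v≢r , refl) c′↑pv v≼b c′≼b)
            l , lw = lwpt₁-exists v
            m , mw = lwpt₁-exists c′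
        in ≤⇒≯ (≤-trans (off-path-T₂-a≤lwpt₁ (≼-trans a′≼pv (child⇒≼ c′↑pv) , b⋠c′) c′⋠b mw)
                         (sibling-lwpt₁-antitone v≢r (proj₁ c′↑pv) (sym (proj₂ c′↑pv)) v<c′ lw mw))
               (lwpt₁-on-path<a (up v≢r a′≼pv) v≼b lw)

    path-leftmost : ∀ {v} → a′ ≼ v → v ≼ b → LeftmostDesc G T a′ v
    path-leftmost here             _   = lm-here
    path-leftmost (up v≢r a′≼pv) v≼b =
      leftmost-snoc (path-leftmost a′≼pv (≼-trans (child⇒≼ (v≢r , refl)) v≼b)) (on-path-left-child v≢r a′≼pv v≼b)

    a′-leftmost : LeftmostDesc G T a′ b
    a′-leftmost = path-leftmost a′≼b here

    stable : Stable G T a b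
    stable = a<b , a′ , a′↑a , a′-leftmost , back-edges
      where
      back-edges : ∀ x y → BackEdge G T x y → a′ ≤ᵥ x → x <ᵥ b → a ≤ᵥ y
      back-edges x y (e , _ , _) a′≤x x<b with y ≟ᶠ a | y ≟ᶠ b
      ... | yes refl | _        = ≤-refl
      ... | no  _    | yes refl = <⇒≤ a<b
      ... | no  y≢a  | no  y≢b  =
        let x∈T₂ = ≼-between x a′≼b a′≤x (<⇒≤ x<b) , <ᵥ⇒⋠ x<b in
        ≼⇒≤ᵥ (B∖A⇒a≼ (Only-B-closed (T₂⇒B∖A x∈T₂) e (y≢a , y≢b)))

    conditions : Conditions A B
    conditions = (a′ , (a′↑a , a′-leftmost , a′≢b) , i , proj₁ (proj₂ cut) , inj₁ shape ,
                  lwpt₁-below-cut , hgpt-from-cut , no-split) , a≢r , stable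

  conditions-swap : ∀ {A B} → Conditions B A → Conditions A B
  conditions-swap ((a′ , a′-props , i , i≤k , shape , rest) , a≢r , stable) =
    (a′ , a′-props , i , i≤k , swap shape , rest) , a≢r , stable

  separation-swap : ∀ {A B} → HalfConnType2SepWith G T A B a b → HalfConnType2SepWith G T B A a b
  separation-swap ((cover , A-only , B-only , no-edge) , separator , half , (r≢a , r≢b , interior , orientation)) =
    (swap ∘ cover , B-only , A-only , λ u v u∈B u∉A v∈A v∉B e → no-edge v u v∈A v∉B u∈B u∉A (edge-sym e)) ,
    (λ v → (λ (v∈B , v∈A) → proj₁ (separator v) (v∈A , v∈B)) ,
           λ v∈ab → let v∈A , v∈B = proj₂ (separator v) v∈ab in v∈B , v∈A) ,
    swap half , r≢a , r≢b , interior , swap orientation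

proposition3p10 :
    ∀ {n : ℕ} (G : Graph n) (T : RootedSpanningTree G) →
    TwoConnected G → Normal G T → Compatible G T →
    ∀ (a b : Fin n) → a <ᵥ b →
    ∀ (k : ℕ) (c : Fin k → Fin n) →
    (∀ (j j' : Fin k) → toℕ j < toℕ j' → c j <ᵥ c j') →
    (∀ (v : Fin n) → ChildOf G T v b ⟺ Σ (Fin k) (λ j → c j ≡ v)) →
    ∀ (A B : Subset n) →
    HalfConnType2SepWith G T A B a b ⟺
      ( Σ (Fin n) (λ a' →
            (ChildOf G T a' a × LeftmostDesc G T a' b × a' ≢ b)
          × Σ ℕ (λ i → i ≤ k
              × (ShapeB G T A B a b a' k c i ⊎ ShapeB G T B A a b a' k c i)
              × (∀ (j : Fin k) → toℕ j < i → ∀ l → Lwpt1 G T (c j) l → a ≤ᵥ l)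
              × (∀ (j : Fin k) → i ≤ toℕ j → ∀ h → Hgpt G T (c j) h → h ≤ᵥ a)
              × ¬ Σ (Fin k) (λ j → Σ (Fin k) (λ j' →
                    toℕ j < i × i ≤ toℕ j'
                    × (ChildOf G T (c j) b × Lwpt1 G T (c j) a × Lwpt2 G T (c j) b)
                    × (ChildOf G T (c j') b × Lwpt1 G T (c j') a × Lwpt2 G T (c j') b)))))
      × a ≢ RootedSpanningTree.root T
      × Stable G T a b )
proposition3p10 G T two-connected normal compatible a b a<b k c c-increasing children-of-b A B =
  necessary , sufficient
  where
  open Setting G T two-connected normal compatible a b a<b k c c-increasing children-of-b
  necessary : HalfConnType2SepWith G T A B a b → Conditions A B
  necessary sep@(_ , _ , _ , _ , _ , _ , inj₁ orientation) = Necessity.conditions A B sep orientation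
  necessary sep@(_ , _ , _ , _ , _ , _ , inj₂ orientation) =
    conditions-swap (Necessity.conditions B A (separation-swap sep) orientation)
  sufficient : Conditions A B → HalfConnType2SepWith G T A B a b
  sufficient ((a′ , (a′↑a , lm , a′≢b) , i , _ , inj₁ shape , low , high , no-split) , a≢r , stable) =
    Sufficiency.half-connected-type-2 A B a′ a′↑a lm a′≢b i shape low high no-split a≢r stable
  sufficient ((a′ , (a′↑a , lm , a′≢b) , i , _ , inj₂ shape , low , high , no-split) , a≢r , stable) =
    separation-swap (Sufficiency.half-connected-type-2 B A a′ a′↑a lm a′≢b i shape low high no-split a≢r stable)
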